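{- With $F(u)=C(x,y,z,u)$, $G(u)=C(x,z,y,u)$, $q=yz$, and $A_y,B_y$ as below, we have (as formal power series) \[ F(u)=\sum_{n\ge 0}\left(\prod_{k=0}^{n-1}B_y(q^k u)\right) A_y(q^n u), \] where \[ A_y(u)=xyu+\frac{xyu}{1-yu} G(1)-\frac{x^2y^2 q u^3}{1-yu}-\frac{x^2y^2 q u^3}{(1-yu)(1-qu)} F(1),\qquad B_y(u)=\frac{x^2y^2 q^2 u^4}{(1-yu)(1-qu)}. \]
   Context: A Catalan word of length $n\geq1$ is a sequence $w_1\cdots w_n$ of nonnegative integers with $w_1=0$ and $w_i\leq w_{i-1}+1$; its Catalan polyomino is the bargraph whose $i$th column has $w_i+1$ cells, columns bottom-aligned; $\mathbf{C}$ is the set of all Catalan polyominoes. For $P\in\mathbf{C}$: $\mathrm{lth}(P)$ = number of columns, $\mathrm{last}(P)$ = number of cells in the last column, $\mathrm{ver}(P)$ = total number of cells in columns of odd index (first column index 1), $\mathrm{white}(P)$ = total number of cells in columns of even index. $s(P)=\mathrm{ver}(P)$ if $\mathrm{lth}(P)$ odd, $s(P)=\mathrm{white}(P)$ if even; $\bar s(P)=\mathrm{ver}(P)$ if $\mathrm{lth}(P)$ even, $\bar s(P)=\mathrm{white}(P)$ if odd. $C(x,y,z,u)=\sum_{P\in\mathbf{C}}x^{\mathrm{lth}(P)}y^{s(P)}z^{\bar s(P)}u^{\mathrm{last}(P)}$. -}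

module Defs where

open import Data.Nat using (ℕ; zero; suc; _∸_; _≡ᵇ_) renaming (_+_ to _+ℕ_)
open import Data.Bool using (Bool; true; false; if_then_else_; _∧_; not)
open import Data.List using (List; []; _∷_; map; concatMap; upTo; reverse; length)
open import Data.Integer using (ℤ; +_; _+_; _*_; _-_)

-- Catalan words of length n, generated in REVERSED order
-- (head of the list = last letter).  A word of length n+1 is obtained
-- from a word of length n ending in h by appending any letter v ≤ h+1.
extendRev : List ℕ → List (List ℕ)
extendRev []      = []
extendRev (h ∷ t) = map (λ v → v ∷ h ∷ t) (upTo (suc (suc h)))

catRev : ℕ → List (List ℕ)
catRev zero             = []
catRev (suc zero)       = (0 ∷ []) ∷ []
catRev (suc (suc n))    = concatMap extendRev (catRev (suc n))

-- All Catalan words w₁⋯wₙ of length n (in normal order), i.e. all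
-- Catalan polyominoes with n columns (column i has wᵢ+1 cells).
catWords : ℕ → List (List ℕ)
catWords n = map reverse (catRev n)

lth : List ℕ → ℕ
lth = length

lastCol : List ℕ → ℕ
lastCol []           = 0
lastCol (w ∷ [])     = suc w
lastCol (w ∷ v ∷ r)  = lastCol (v ∷ r)

-- cells in columns of odd / even index (first column has index 1)
oddCells evenCells : List ℕ → ℕ
oddCells []        = 0
oddCells (w ∷ r)   = suc w +ℕ evenCells r
evenCells []       = 0
evenCells (w ∷ r)  = oddCells r

ver white : List ℕ → ℕ
ver   = oddCells
white = evenCells

isOdd : ℕ → Bool
isOdd zero    = false
isOdd (suc n) = not (isOdd n)

s sbar : List ℕ → ℕ
s    w = if isOdd (lth w) then ver w else white w
sbar w = if isOdd (lth w) then white w else ver w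

-- Formal power series in x, y, z, u with integer coefficients:
-- f a b c d = coefficient of x^a y^b z^c u^d.

PS : Set
PS = ℕ → ℕ → ℕ → ℕ → ℤ

countB : {A : Set} → (A → Bool) → List A → ℕ
countB p []      = 0
countB p (a ∷ r) = if p a then suc (countB p r) else countB p r

catSeries : (List ℕ → ℕ) → (List ℕ → ℕ) → (List ℕ → ℕ) → PS
catSeries ey ez eu a b c d =
  + countB (λ w → (ey w ≡ᵇ b) ∧ ((ez w ≡ᵇ c) ∧ (eu w ≡ᵇ d))) (catWords a)

zeroU : List ℕ → ℕ
zeroU _ = 0

F G F1 G1 : PS
F  = catSeries s sbar lastCol
G  = catSeries sbar s lastCol
F1 = catSeries s sbar zeroU
G1 = catSeries sbar s zeroU

sumTo : ℕ → (ℕ → ℤ) → ℤ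
sumTo zero    f = + 0
sumTo (suc n) f = sumTo n f + f n

infixl 6 _⊕_ _⊖_
infixl 7 _⊗_

_⊕_ _⊖_ _⊗_ : PS → PS → PS
(f ⊕ g) a b c d = f a b c d + g a b c d
(f ⊖ g) a b c d = f a b c d - g a b c d
(f ⊗ g) a b c d =
  sumTo (suc a) λ i → sumTo (suc b) λ j → sumTo (suc c) λ k → sumTo (suc d) λ l →
    f i j k l * g (a ∸ i) (b ∸ j) (c ∸ k) (d ∸ l)

one : PS
one a b c d = if (a ≡ᵇ 0) ∧ ((b ≡ᵇ 0) ∧ ((c ≡ᵇ 0) ∧ (d ≡ᵇ 0))) then + 1 else + 0

X Y Z U : PS
X a b c d = if (a ≡ᵇ 1) ∧ ((b ≡ᵇ 0) ∧ ((c ≡ᵇ 0) ∧ (d ≡ᵇ 0))) then + 1 else + 0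
Y a b c d = if (a ≡ᵇ 0) ∧ ((b ≡ᵇ 1) ∧ ((c ≡ᵇ 0) ∧ (d ≡ᵇ 0))) then + 1 else + 0
Z a b c d = if (a ≡ᵇ 0) ∧ ((b ≡ᵇ 0) ∧ ((c ≡ᵇ 1) ∧ (d ≡ᵇ 0))) then + 1 else + 0
U a b c d = if (a ≡ᵇ 0) ∧ ((b ≡ᵇ 0) ∧ ((c ≡ᵇ 0) ∧ (d ≡ᵇ 1))) then + 1 else + 0

pow : PS → ℕ → PS
pow f zero    = one
pow f (suc k) = pow f k ⊗ f

-- 1/(1-f) = Σ_k f^k, for f with zero constant term: the coefficient of a
-- monomial of total degree D only receives contributions from k ≤ D.
inv1m : PS → PS
inv1m f a b c d = sumTo (suc (a +ℕ b +ℕ c +ℕ d)) λ k → pow f k a b c d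

Q : PS
Q = Y ⊗ Z

-- substitution u ↦ q^k u :  x^a y^b z^c u^d ↦ x^a y^(b+kd) z^(c+kd) u^d
substQ : ℕ → PS → PS
substQ k f a b c d =
  if (k Data.Nat.* d Data.Nat.≤ᵇ b) ∧ (k Data.Nat.* d Data.Nat.≤ᵇ c)
  then f a (b ∸ k Data.Nat.* d) (c ∸ k Data.Nat.* d) d else + 0

Ay : PS
Ay = X ⊗ Y ⊗ U
   ⊕ X ⊗ Y ⊗ U ⊗ inv1m (Y ⊗ U) ⊗ G1
   ⊖ pow X 2 ⊗ pow Y 2 ⊗ Q ⊗ pow U 3 ⊗ inv1m (Y ⊗ U)
   ⊖ pow X 2 ⊗ pow Y 2 ⊗ Q ⊗ pow U 3 ⊗ inv1m (Y ⊗ U) ⊗ inv1m (Q ⊗ U) ⊗ F1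

By : PS
By = pow X 2 ⊗ pow Y 2 ⊗ pow Q 2 ⊗ pow U 4 ⊗ inv1m (Y ⊗ U) ⊗ inv1m (Q ⊗ U)

prodB : ℕ → PS
prodB zero    = one
prodB (suc n) = prodB n ⊗ substQ n By

term : ℕ → PS
term n = prodB n ⊗ substQ n Ay

partialSum : ℕ → PS
partialSum M a b c d = sumTo M λ n → term n a b c d

{-# OPTIONS --safe #-}
module Submission where

-- Read a Catalan word backwards, last column first. A word ending in a column of v + 1 cells
-- is a shorter word r extended by that column; its weight is (yu)^(v+1) times the weight of r
-- with y and z exchanged (the parities of the column indices flip) and u ↦ 1, and v ranges over
-- 0, …, h + 1 where h + 1 is the height of the last column of r. Summing this geometric series gives
--   (1 - yu) F(u) = xyu (1 - yu) + xyu G(1) - xy²u² G(yu),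
-- and in the same way, with qu = yzu in place of yu,
--   (1 - qu) G(yu) = xqu (1 - qu) + xqu F(1) - xq²u² F(qu).
-- Solving both for F(u) and G(yu) with the inverses of 1 - yu and 1 - qu and substituting the
-- second into the first gives F(u) = A_y(u) + B_y(u) F(qu). The substitution u ↦ qᵏu multiplies
-- the coefficient of uⁿ by q^(kn), so it is a ring homomorphism, and iterating M times gives the
-- partial sum plus (Π_{k<M} B_y(qᵏu)) F(q^M u), which is divisible by x^(2M).

open import Defs
open import Data.Nat using (ℕ; _≤_)
open import Data.Product using (∃-syntax)
open import Relation.Binary.PropositionalEquality using (_≡_)

open import Algebra.Bundles using (CommutativeRing)
open import Algebra.Core using (Op₂)
import Algebra.Construct.Pointwise as Pointwise
import Algebra.Properties.Group as GroupProperties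
import Algebra.Properties.Ring as RingProperties
open import Algebra.Solver.Ring.AlmostCommutativeRing using (fromCommutativeRing; _-Raw-AlmostCommutative⟶_)
open import Algebra.Structures using (IsCommutativeRing)
open import Data.Bool using (Bool; true; false; if_then_else_; _∧_; not; T)
open import Data.Bool.Properties using (∧-identityʳ; ∧-zeroʳ)
open import Data.Fin using (Fin; toℕ; inject₁; fromℕ; opposite)
open import Data.Fin.Properties using (toℕ-inject₁; toℕ-fromℕ; toℕ≤pred[n]; opposite-prop)
import Data.Fin.Permutation as Permutation
open import Data.Integer using (ℤ; +_) renaming (_+_ to _+ℤ_; _*_ to _*ℤ_; -_ to -ℤ_)
import Data.Integer.Properties as ℤ
open import Data.List using (List; []; _∷_; _∷ʳ_; _++_; length; reverse; map; concatMap; foldr; applyUpTo; upTo)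
open import Data.List.Properties using (unfold-reverse)
open import Data.Maybe using (Maybe; just; nothing)
open import Data.Nat as ℕ using (zero; suc; _∸_; _<_; _≡ᵇ_; _≤ᵇ_; _<ᵇ_; s≤s)
import Data.Nat.Properties as ℕ
open import Data.Product using (_,_)
open import Data.Unit using (tt)
open import Data.Vec.Functional as Vector using (Vector)
open import Function using (id; _∘_)
open import Level using (Level; 0ℓ)
open import Relation.Nullary using (yes; no)
import Relation.Binary.PropositionalEquality as ≡
import Relation.Binary.Reasoning.Setoid as SetoidReasoning

module PowerSeries {c ℓ} (R : CommutativeRing c ℓ) where

  open CommutativeRing R hiding (isCommutativeRing)
  open RingProperties ring using (-0#≈0#)
  open import Algebra.Properties.CommutativeSemigroup *-commutativeSemigroup using (interchange)
  open import Algebra.Properties.CommutativeSemiring.Exp commutativeSemiring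
    using (_^_; ^-congˡ; ^-homo-*; ^-distrib-*)
  open import Algebra.Properties.Semiring.Sum semiring
    using (sum; sum-syntax; sum-cong-≋; sum-replicate-zero; sum-permute; ∑-distrib-+; *-distribˡ-sum)
  open import Relation.Binary.Reasoning.Setoid setoid

  Series : Set c
  Series = ℕ → Carrier

  infix 4 _≈ₛ_
  infixl 6 _+ₛ_ _-ₛ_
  infixl 7 _*ₛ_
  infix 8 -ₛ_

  _≈ₛ_ : Series → Series → Set ℓ
  f ≈ₛ g = ∀ n → f n ≈ g n

  _+ₛ_ : Series → Series → Series
  (f +ₛ g) n = f n + g n

  -ₛ_ : Series → Series
  (-ₛ f) n = - f n

  _-ₛ_ : Series → Series → Series
  f -ₛ g = f +ₛ -ₛ g

  0ₛ : Series
  0ₛ _ = 0#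

  monomial : ℕ → Carrier → Series
  monomial k r n = if n ≡ᵇ k then r else 0#

  1ₛ : Series
  1ₛ = monomial 0 1#

  convolution : Series → Series → (n : ℕ) → Vector Carrier (suc n)
  convolution f g n i = f (toℕ i) * g (n ∸ toℕ i)

  _*ₛ_ : Series → Series → Series
  (f *ₛ g) n = sum (convolution f g n)

  sum-≈0 : ∀ {n} (v : Vector Carrier n) → (∀ i → v i ≈ 0#) → sum v ≈ 0#
  sum-≈0 {n} v v≈0 = trans (sum-cong-≋ {x = v} v≈0) (sum-replicate-zero n)

  ∑ₛ : ∀ {m} → Vector Series m → Series
  ∑ₛ = Vector.foldr _+ₛ_ 0ₛ

  sum-apply : ∀ {m} (v : Vector Series m) n → ∑ₛ v n ≈ sum (λ i → v i n)
  sum-apply {zero}  v n = refl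
  sum-apply {suc m} v n = +-congˡ (sum-apply (Vector.tail v) n)

  -- The first term of a Cauchy product splits off definitionally:
  -- (f *ₛ g) (suc n) = f 0 * g (suc n) + ((f ∘ suc) *ₛ g) n.

  *ₛ-zero : ∀ f g → (f *ₛ g) 0 ≈ f 0 * g 0
  *ₛ-zero f g = +-identityʳ _

  *ₛ-cong : ∀ {f f′ g g′} → f ≈ₛ f′ → g ≈ₛ g′ → f *ₛ g ≈ₛ f′ *ₛ g′
  *ₛ-cong {f} {f′} {g} {g′} f≈f′ g≈g′ n =
    sum-cong-≋ {x = convolution f g n} {y = convolution f′ g′ n} (λ i → *-cong (f≈f′ _) (g≈g′ _))

  *ₛ-zeroˡ : ∀ f → 0ₛ *ₛ f ≈ₛ 0ₛ
  *ₛ-zeroˡ f n = sum-≈0 (convolution 0ₛ f n) (λ i → zeroˡ _)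

  *ₛ-comm : ∀ f g → f *ₛ g ≈ₛ g *ₛ f
  *ₛ-comm f g n = trans (sum-permute (convolution f g n) Permutation.reverse)
                        (sum-cong-≋ {x = λ i → convolution f g n (opposite i)} {y = convolution g f n} swap)
    where
    swap : ∀ (i : Fin (suc n)) →
           f (toℕ (opposite i)) * g (n ∸ toℕ (opposite i)) ≈ g (toℕ i) * f (n ∸ toℕ i)
    swap i = trans (*-comm _ _) (*-cong (reflexive (≡.cong g n∸[n∸i]≡i)) (reflexive (≡.cong f (opposite-prop i))))
      where
      n∸[n∸i]≡i : n ∸ toℕ (opposite i) ≡ toℕ i
      n∸[n∸i]≡i = ≡.trans (≡.cong (n ∸_) (opposite-prop i)) (ℕ.m∸[m∸n]≡n (toℕ≤pred[n] i))

  *ₛ-distribʳ : ∀ f g h → (g +ₛ h) *ₛ f ≈ₛ g *ₛ f +ₛ h *ₛ f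
  *ₛ-distribʳ f g h n =
    trans (sum-cong-≋ {x = convolution (g +ₛ h) f n} {y = λ i → convolution g f n i + convolution h f n i}
                      (λ i → distribʳ _ _ _))
          (∑-distrib-+ (convolution g f n) (convolution h f n))

  <ᵇ-suc : ∀ k n → (k <ᵇ suc n) ≡ (k ≤ᵇ n)
  <ᵇ-suc zero    n = ≡.refl
  <ᵇ-suc (suc k) n = ≡.refl

  monomial-*ₛ : ∀ k r f n → (monomial k r *ₛ f) n ≈ (if k ≤ᵇ n then r * f (n ∸ k) else 0#)
  monomial-*ₛ zero    r f zero    = +-identityʳ _
  monomial-*ₛ zero    r f (suc n) = trans (+-congˡ (*ₛ-zeroˡ f n)) (+-identityʳ _)
  monomial-*ₛ (suc k) r f zero    = trans (+-identityʳ _) (zeroˡ _)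
  monomial-*ₛ (suc k) r f (suc n) rewrite <ᵇ-suc k n =
    trans (+-congʳ (zeroˡ _)) (trans (+-identityˡ _) (monomial-*ₛ k r f n))

  *ₛ-identityˡ : ∀ f → 1ₛ *ₛ f ≈ₛ f
  *ₛ-identityˡ f n = trans (monomial-*ₛ 0 1# f n) (*-identityˡ (f n))

  scale : Carrier → Series → Series
  scale r f n = r * f n

  scale-*ₛ : ∀ r f g → scale r f *ₛ g ≈ₛ scale r (f *ₛ g)
  scale-*ₛ r f g n =
    trans (sum-cong-≋ {x = convolution (scale r f) g n} {y = λ i → r * convolution f g n i} (λ i → *-assoc _ _ _))
          (sym (*-distribˡ-sum r (convolution f g n)))

  *ₛ-assoc : ∀ f g h → (f *ₛ g) *ₛ h ≈ₛ f *ₛ (g *ₛ h)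
  *ₛ-assoc f g h zero = begin
    ((f *ₛ g) *ₛ h) 0     ≈⟨ *ₛ-zero (f *ₛ g) h ⟩
    (f *ₛ g) 0 * h 0      ≈⟨ *-congʳ (*ₛ-zero f g) ⟩
    f 0 * g 0 * h 0       ≈⟨ *-assoc _ _ _ ⟩
    f 0 * (g 0 * h 0)     ≈⟨ *-congˡ (*ₛ-zero g h) ⟨
    f 0 * (g *ₛ h) 0      ≈⟨ *ₛ-zero f (g *ₛ h) ⟨
    (f *ₛ (g *ₛ h)) 0     ∎
  *ₛ-assoc f g h (suc n) = begin
    (f *ₛ g) 0 * h (suc n) + ((scale (f 0) g′ +ₛ f′ *ₛ g) *ₛ h) n
      ≈⟨ +-cong (*-congʳ (*ₛ-zero f g)) (*ₛ-distribʳ h (scale (f 0) g′) (f′ *ₛ g) n) ⟩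
    f 0 * g 0 * h (suc n) + ((scale (f 0) g′ *ₛ h) n + ((f′ *ₛ g) *ₛ h) n)
      ≈⟨ +-congˡ (+-cong (scale-*ₛ (f 0) g′ h n) (*ₛ-assoc f′ g h n)) ⟩
    f 0 * g 0 * h (suc n) + (f 0 * (g′ *ₛ h) n + (f′ *ₛ (g *ₛ h)) n)
      ≈⟨ +-assoc _ _ _ ⟨
    f 0 * g 0 * h (suc n) + f 0 * (g′ *ₛ h) n + (f′ *ₛ (g *ₛ h)) n
      ≈⟨ +-congʳ (trans (+-congʳ (*-assoc _ _ _)) (sym (distribˡ _ _ _))) ⟩
    f 0 * (g 0 * h (suc n) + (g′ *ₛ h) n) + (f′ *ₛ (g *ₛ h)) n
      ∎
    where
    f′ g′ : Series
    f′ i = f (suc i)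
    g′ i = g (suc i)

  isCommutativeRing : IsCommutativeRing _≈ₛ_ _+ₛ_ _*ₛ_ -ₛ_ 0ₛ 1ₛ
  isCommutativeRing = record
    { isRing = record
      { +-isAbelianGroup = Pointwise.isAbelianGroup ℕ +-isAbelianGroup
      ; *-cong           = *ₛ-cong
      ; *-assoc          = *ₛ-assoc
      ; *-identity       = *ₛ-identityˡ , λ f n → trans (*ₛ-comm f 1ₛ n) (*ₛ-identityˡ f n)
      ; distrib          = (λ f g h n → trans (*ₛ-comm f (g +ₛ h) n)
                                          (trans (*ₛ-distribʳ f g h n) (+-cong (*ₛ-comm g f n) (*ₛ-comm h f n))))
                         , *ₛ-distribʳ
      }
    ; *-comm = *ₛ-comm
    }

  commutativeRing : CommutativeRing c ℓ
  commutativeRing = record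
    { Carrier = Series ; _≈_ = _≈ₛ_ ; _+_ = _+ₛ_ ; _*_ = _*ₛ_ ; -_ = -ₛ_ ; 0# = 0ₛ ; 1# = 1ₛ
    ; isCommutativeRing = isCommutativeRing }

  open import Algebra.Properties.Semiring.Exp (CommutativeRing.semiring commutativeRing) public
    using () renaming (_^_ to _^ₛ_; ^-congˡ to ^ₛ-congˡ)

  monomial-cong : ∀ k {r s} → r ≈ s → monomial k r ≈ₛ monomial k s
  monomial-cong k r≈s n with n ≡ᵇ k
  ... | true  = r≈s
  ... | false = refl

  monomial-*ₛ-monomial : ∀ k m r s → monomial k r *ₛ monomial m s ≈ₛ monomial (k ℕ.+ m) (r * s)
  monomial-*ₛ-monomial k m r s n = trans (monomial-*ₛ k r (monomial m s) n) (shifted k n)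
    where
    shifted : ∀ k n → (if k ≤ᵇ n then r * monomial m s (n ∸ k) else 0#) ≈ monomial (k ℕ.+ m) (r * s) n
    shifted zero    n with n ≡ᵇ m
    ... | true  = refl
    ... | false = zeroʳ r
    shifted (suc k) zero    = refl
    shifted (suc k) (suc n) rewrite <ᵇ-suc k n = shifted k n

  1#^n≈1# : ∀ n → 1# ^ n ≈ 1#
  1#^n≈1# zero    = refl
  1#^n≈1# (suc n) = trans (*-identityˡ _) (1#^n≈1# n)

  monomial-^ₛ : ∀ e r k → monomial e r ^ₛ k ≈ₛ monomial (k ℕ.* e) (r ^ k)
  monomial-^ₛ e r zero    n = refl
  monomial-^ₛ e r (suc k) n =
    trans (*ₛ-cong {monomial e r} (λ _ → refl) (monomial-^ₛ e r k) n) (monomial-*ₛ-monomial e (k ℕ.* e) r (r ^ k) n)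

  -- twist t f is f(t u).
  twist : Carrier → Series → Series
  twist t f n = t ^ n * f n

  twist-cong : ∀ {s t f g} → s ≈ t → f ≈ₛ g → twist s f ≈ₛ twist t g
  twist-cong s≈t f≈g n = *-cong (^-congˡ n s≈t) (f≈g n)

  twist-*ₛ : ∀ t f g → twist t (f *ₛ g) ≈ₛ twist t f *ₛ twist t g
  twist-*ₛ t f g n =
    trans (*-distribˡ-sum (t ^ n) (convolution f g n))
          (sum-cong-≋ {x = λ i → t ^ n * convolution f g n i} {y = convolution (twist t f) (twist t g) n} split)
    where
    split : ∀ (i : Fin (suc n)) →
            t ^ n * (f (toℕ i) * g (n ∸ toℕ i)) ≈ t ^ toℕ i * f (toℕ i) * (t ^ (n ∸ toℕ i) * g (n ∸ toℕ i))
    split i = begin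
      t ^ n * (f i′ * g (n ∸ i′))                          ≈⟨ *-congʳ (reflexive (≡.cong (t ^_) (ℕ.m+[n∸m]≡n (toℕ≤pred[n] i)))) ⟨
      t ^ (i′ ℕ.+ (n ∸ i′)) * (f i′ * g (n ∸ i′))          ≈⟨ *-congʳ (^-homo-* t i′ (n ∸ i′)) ⟩
      t ^ i′ * t ^ (n ∸ i′) * (f i′ * g (n ∸ i′))          ≈⟨ interchange _ _ _ _ ⟩
      t ^ i′ * f i′ * (t ^ (n ∸ i′) * g (n ∸ i′))          ∎
      where i′ = toℕ i

  twist-monomial : ∀ t k r → twist t (monomial k r) ≈ₛ monomial k (t ^ k * r)
  twist-monomial t k r n with n ≡ᵇ k in n≡ᵇk
  ... | true  = *-congʳ (reflexive (≡.cong (t ^_) (ℕ.≡ᵇ⇒≡ n k (≡.subst T (≡.sym n≡ᵇk) tt))))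
  ... | false = zeroʳ _

  twist-twist : ∀ s t f → twist s (twist t f) ≈ₛ twist (s * t) f
  twist-twist s t f n = trans (sym (*-assoc _ _ _)) (*-congʳ (sym (^-distrib-* s t n)))

  geometric : Carrier → Series
  geometric t n = t ^ n

  geometric-inverse : ∀ t → (1ₛ -ₛ monomial 1 t) *ₛ geometric t ≈ₛ 1ₛ
  geometric-inverse t n = trans ([y-z]x≈yx-zx (geometric t) 1ₛ (monomial 1 t) n) (coefficient n)
    where
    open RingProperties (CommutativeRing.ring commutativeRing) using ([y-z]x≈yx-zx)
    coefficient : ∀ n → (1ₛ *ₛ geometric t) n - (monomial 1 t *ₛ geometric t) n ≈ 1ₛ n
    coefficient zero    = trans (+-cong (*ₛ-identityˡ (geometric t) 0) (-‿cong (monomial-*ₛ 1 t (geometric t) 0)))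
                                (trans (+-congˡ -0#≈0#) (+-identityʳ _))
    coefficient (suc n) = trans (+-cong (*ₛ-identityˡ (geometric t) (suc n)) (-‿cong (monomial-*ₛ 1 t (geometric t) (suc n))))
                                (-‿inverseʳ _)

  VanishesBelow : ℕ → Series → Set ℓ
  VanishesBelow k f = ∀ n → n < k → f n ≈ 0#

  monomial-vanishesBelow : ∀ k r → VanishesBelow k (monomial k r)
  monomial-vanishesBelow (suc k) r zero    _         = refl
  monomial-vanishesBelow (suc k) r (suc n) (s≤s n<k) = monomial-vanishesBelow k r n n<k

  *ₛ-vanishesBelow : ∀ k m {f g} → VanishesBelow k f → VanishesBelow m g → VanishesBelow (k ℕ.+ m) (f *ₛ g)
  *ₛ-vanishesBelow zero    m {f} {g} _ g≈0 n n<m =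
    sum-≈0 (convolution f g n) (λ i → trans (*-congˡ (g≈0 _ (ℕ.≤-<-trans (ℕ.m∸n≤m n (toℕ i)) n<m))) (zeroʳ _))
  *ₛ-vanishesBelow (suc k) m {f} {g} f≈0 g≈0 zero    _ =
    trans (*ₛ-zero f g) (trans (*-congʳ (f≈0 0 (s≤s ℕ.z≤n))) (zeroˡ _))
  *ₛ-vanishesBelow (suc k) m {f} {g} f≈0 g≈0 (suc n) (s≤s n<k+m) =
    trans (+-cong (trans (*-congʳ (f≈0 0 (s≤s ℕ.z≤n))) (zeroˡ _))
                  (*ₛ-vanishesBelow k m {λ i → f (suc i)} (λ i i<k → f≈0 (suc i) (s≤s i<k)) g≈0 n n<k+m))
          (+-identityʳ _)

module ListSum {c ℓ} (R : CommutativeRing c ℓ) where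

  open CommutativeRing R
  open import Relation.Binary.Reasoning.Setoid setoid

  private
    variable
      a : Level
      A B : Set a

  ∑ₗ : List A → (A → Carrier) → Carrier
  ∑ₗ xs f = foldr (λ x s → f x + s) 0# xs

  ∑ₗ-cong : ∀ (xs : List A) {f g} → (∀ x → f x ≈ g x) → ∑ₗ xs f ≈ ∑ₗ xs g
  ∑ₗ-cong []       f≈g = refl
  ∑ₗ-cong (x ∷ xs) f≈g = +-cong (f≈g x) (∑ₗ-cong xs f≈g)

  ∑ₗ-map : ∀ (g : A → B) xs f → ∑ₗ (map g xs) f ≡ ∑ₗ xs (λ x → f (g x))
  ∑ₗ-map g []       f = ≡.refl
  ∑ₗ-map g (x ∷ xs) f = ≡.cong (λ s → f (g x) + s) (∑ₗ-map g xs f)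

  ∑ₗ-++ : ∀ (xs ys : List A) f → ∑ₗ (xs ++ ys) f ≈ ∑ₗ xs f + ∑ₗ ys f
  ∑ₗ-++ []       ys f = sym (+-identityˡ _)
  ∑ₗ-++ (x ∷ xs) ys f = trans (+-congˡ (∑ₗ-++ xs ys f)) (sym (+-assoc _ _ _))

  ∑ₗ-concatMap : ∀ (g : A → List B) xs f → ∑ₗ (concatMap g xs) f ≈ ∑ₗ xs (λ x → ∑ₗ (g x) f)
  ∑ₗ-concatMap g []       f = refl
  ∑ₗ-concatMap g (x ∷ xs) f = trans (∑ₗ-++ (g x) (concatMap g xs) f) (+-congˡ (∑ₗ-concatMap g xs f))

  ∑ₗ-+ : ∀ (xs : List A) f g → ∑ₗ xs (λ x → f x + g x) ≈ ∑ₗ xs f + ∑ₗ xs g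
  ∑ₗ-+ []       f g = sym (+-identityˡ _)
  ∑ₗ-+ (x ∷ xs) f g = begin
    f x + g x + ∑ₗ xs (λ x → f x + g x)     ≈⟨ +-congˡ (∑ₗ-+ xs f g) ⟩
    f x + g x + (∑ₗ xs f + ∑ₗ xs g)         ≈⟨ +-assoc _ _ _ ⟩
    f x + (g x + (∑ₗ xs f + ∑ₗ xs g))       ≈⟨ +-congˡ (+-assoc _ _ _) ⟨
    f x + (g x + ∑ₗ xs f + ∑ₗ xs g)         ≈⟨ +-congˡ (+-congʳ (+-comm _ _)) ⟩
    f x + (∑ₗ xs f + g x + ∑ₗ xs g)         ≈⟨ +-congˡ (+-assoc _ _ _) ⟩
    f x + (∑ₗ xs f + (g x + ∑ₗ xs g))       ≈⟨ +-assoc _ _ _ ⟨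
    f x + ∑ₗ xs f + (g x + ∑ₗ xs g)         ∎

  *-distribˡ-∑ₗ : ∀ t (xs : List A) f → t * ∑ₗ xs f ≈ ∑ₗ xs (λ x → t * f x)
  *-distribˡ-∑ₗ t []       f = zeroʳ t
  *-distribˡ-∑ₗ t (x ∷ xs) f = trans (distribˡ t _ _) (+-congˡ (*-distribˡ-∑ₗ t xs f))

  ∑ₗ-applyUpTo-suc : ∀ N (h : ℕ → ℕ) f → ∑ₗ (applyUpTo (suc ∘ h) N) f ≡ ∑ₗ (applyUpTo h N) (f ∘ suc)
  ∑ₗ-applyUpTo-suc zero    h f = ≡.refl
  ∑ₗ-applyUpTo-suc (suc N) h f = ≡.cong (λ s → f (suc (h 0)) + s) (∑ₗ-applyUpTo-suc N (h ∘ suc) f)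

  ∑ₗ-applyUpTo-telescope : ∀ N (h : ℕ → ℕ) f →
    ∑ₗ (applyUpTo h N) f + f (h N) ≈ f (h 0) + ∑ₗ (applyUpTo (h ∘ suc) N) f
  ∑ₗ-applyUpTo-telescope zero    h f = +-comm _ _
  ∑ₗ-applyUpTo-telescope (suc N) h f =
    trans (+-assoc _ _ _) (+-congˡ (∑ₗ-applyUpTo-telescope N (h ∘ suc) f))

  ∑ₗ-upTo-telescope : ∀ N f → ∑ₗ (upTo N) f + f N ≈ f 0 + ∑ₗ (upTo N) (f ∘ suc)
  ∑ₗ-upTo-telescope N f =
    trans (∑ₗ-applyUpTo-telescope N id f) (+-congˡ (reflexive (∑ₗ-applyUpTo-suc N id f)))

module _ {c ℓ} (R : CommutativeRing c ℓ) where
  open CommutativeRing R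
  open import Relation.Binary.Reasoning.Setoid setoid

  isCommutativeRing-with : ∀ {_∙_ : Op₂ Carrier} {e} → (∀ x y → (x ∙ y) ≈ x * y) → e ≈ 1# →
                           IsCommutativeRing _≈_ _+_ _∙_ -_ 0# e
  isCommutativeRing-with {_∙_} {e} ∙≈* e≈1 = record
    { isRing = record
      { +-isAbelianGroup = +-isAbelianGroup
      ; *-cong = λ {x} {x′} {y} {y′} x≈x′ y≈y′ → trans (∙≈* x y) (trans (*-cong x≈x′ y≈y′) (sym (∙≈* x′ y′)))
      ; *-assoc = λ x y z → begin
          (x ∙ y) ∙ z   ≈⟨ ∙≈* _ z ⟩
          (x ∙ y) * z   ≈⟨ *-congʳ (∙≈* x y) ⟩
          x * y * z     ≈⟨ *-assoc x y z ⟩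
          x * (y * z)   ≈⟨ *-congˡ (∙≈* y z) ⟨
          x * (y ∙ z)   ≈⟨ ∙≈* x _ ⟨
          x ∙ (y ∙ z)   ∎
      ; *-identity = (λ x → trans (∙≈* e x) (trans (*-congʳ e≈1) (*-identityˡ x)))
                   , (λ x → trans (∙≈* x e) (trans (*-congˡ e≈1) (*-identityʳ x)))
      ; distrib = (λ x y z → trans (∙≈* x _) (trans (distribˡ x y z) (sym (+-cong (∙≈* x y) (∙≈* x z)))))
                , (λ x y z → trans (∙≈* _ x) (trans (distribʳ x y z) (sym (+-cong (∙≈* y x) (∙≈* z x)))))
      }
    ; *-comm = λ x y → trans (∙≈* x y) (trans (*-comm x y) (sym (∙≈* y x)))
    }

-- ι only supplies the integer coefficients of the ring solver.
module RingAlgebra {c ℓ} (R : CommutativeRing c ℓ)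
  (ι : CommutativeRing.rawRing ℤ.+-*-commutativeRing -Raw-AlmostCommutative⟶ fromCommutativeRing R) where

  open CommutativeRing R
  open _-Raw-AlmostCommutative⟶_ ι using (⟦_⟧)

  ι-≟ : ∀ r s → Maybe (⟦ r ⟧ ≈ ⟦ s ⟧)
  ι-≟ r s with r ℤ.≟ s
  ... | yes ≡.refl = just refl
  ... | no _       = nothing

  open import Algebra.Solver.Ring (CommutativeRing.rawRing ℤ.+-*-commutativeRing) (fromCommutativeRing R) ι ι-≟
  open GroupProperties +-group using (x∙y⁻¹≈ε⇒x≈y; x≈y⇒x∙y⁻¹≈ε)

  linear-identity : ∀ x y z i c w →
    x - (c + c * i * z - c * w * i * y) ≈
    i * ((x + (c * w + c * w * y)) - (w * x + (c + c * z))) + ((c - x) * (i - w * i) - (c - x))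
  linear-identity = solve 6 (λ x y z i c w →
    x :- (c :+ c :* i :* z :- c :* w :* i :* y) :=
    i :* ((x :+ (c :* w :+ c :* w :* y)) :- (w :* x :+ (c :+ c :* z))) :+ ((c :- x) :* (i :- w :* i) :- (c :- x))) refl

  substitution-identity : ∀ a w b v iy iq g1 f1 fq →
    a + a * iy * g1 - a * w * iy * (b + b * iq * f1 - b * v * iq * fq) ≈
    a + a * iy * g1 - a * w * b * iy - a * w * b * iy * iq * f1 + a * w * b * v * iy * iq * fq
  substitution-identity = solve 9 (λ a w b v iy iq g1 f1 fq →
    a :+ a :* iy :* g1 :- a :* w :* iy :* (b :+ b :* iq :* f1 :- b :* v :* iq :* fq) :=
    a :+ a :* iy :* g1 :- a :* w :* b :* iy :- a :* w :* b :* iy :* iq :* f1 :+ a :* w :* b :* v :* iy :* iq :* fq) refl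

  open import Relation.Binary.Reasoning.Setoid setoid
  open RingProperties ring using ([y-z]x≈yx-zx)

  -- The first hypothesis is (1 - w) x = c (1 - w) + c z - c w y with the subtractions moved across.
  linear-solution : ∀ {x y z i c w} → x + (c * w + c * w * y) ≈ w * x + (c + c * z) → (1# - w) * i ≈ 1# →
                    x ≈ c + c * i * z - c * w * i * y
  linear-solution {x} {y} {z} {i} {c} {w} equation inverse = x∙y⁻¹≈ε⇒x≈y _ _ (begin
    x - (c + c * i * z - c * w * i * y)
      ≈⟨ linear-identity x y z i c w ⟩
    i * ((x + (c * w + c * w * y)) - (w * x + (c + c * z))) + ((c - x) * (i - w * i) - (c - x))
      ≈⟨ +-cong (trans (*-congˡ (x≈y⇒x∙y⁻¹≈ε equation)) (zeroʳ i))
                (trans (+-congʳ (trans (*-congˡ i-wi≈1) (*-identityʳ (c - x)))) (-‿inverseʳ (c - x))) ⟩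
    0# + 0#
      ≈⟨ +-identityʳ 0# ⟩
    0# ∎)
    where
    i-wi≈1 : i - w * i ≈ 1#
    i-wi≈1 = trans (+-congʳ (sym (*-identityˡ i))) (trans (sym ([y-z]x≈yx-zx i 1# w)) inverse)

  eliminate : ∀ {f gy g1 f1 fq iy iq a w b v p p′} →
    f + (a * w + a * w * gy) ≈ w * f + (a + a * g1) →
    gy + (b * v + b * v * fq) ≈ v * gy + (b + b * f1) →
    (1# - w) * iy ≈ 1# → (1# - v) * iq ≈ 1# →
    a * w * b ≈ p → a * w * b * v ≈ p′ →
    f ≈ a + a * iy * g1 - p * iy - p * iy * iq * f1 + p′ * iy * iq * fq
  eliminate {f} {gy} {g1} {f1} {fq} {iy} {iq} {a} {w} {b} {v} {p} {p′} first second iy-inverse iq-inverse awb≈p awbv≈p′ = begin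
    f
      ≈⟨ linear-solution first iy-inverse ⟩
    a + a * iy * g1 - a * w * iy * gy
      ≈⟨ +-congˡ (-‿cong (*-congˡ (linear-solution second iq-inverse))) ⟩
    a + a * iy * g1 - a * w * iy * (b + b * iq * f1 - b * v * iq * fq)
      ≈⟨ substitution-identity a w b v iy iq g1 f1 fq ⟩
    a + a * iy * g1 - a * w * b * iy - a * w * b * iy * iq * f1 + a * w * b * v * iy * iq * fq
      ≈⟨ +-cong (+-cong (+-congˡ (-‿cong (*-congʳ awb≈p))) (-‿cong (*-congʳ (*-congʳ (*-congʳ awb≈p)))))
                (*-congʳ (*-congʳ (*-congʳ awbv≈p′))) ⟩
    a + a * iy * g1 - p * iy - p * iy * iq * f1 + p′ * iy * iq * fq ∎

  distribute : ∀ s m x y z → s + m * (x + y * z) ≈ s + m * x + m * y * z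
  distribute = solve 5 (λ s m x y z → s :+ m :* (x :+ y :* z) := s :+ m :* x :+ m :* y :* z) refl

  column-equation-cong : ∀ {φ φ′ ψ ψ′ θ θ′ a a′ w w′} → φ ≈ φ′ → ψ ≈ ψ′ → θ ≈ θ′ → a ≈ a′ → w ≈ w′ →
    φ + (a * w + a * w * θ) ≈ w * φ + (a + a * ψ) → φ′ + (a′ * w′ + a′ * w′ * θ′) ≈ w′ * φ′ + (a′ + a′ * ψ′)
  column-equation-cong φ≈ ψ≈ θ≈ a≈ w≈ equation =
    trans (sym (+-cong φ≈ (+-cong (*-cong a≈ w≈) (*-cong (*-cong a≈ w≈) θ≈))))
          (trans equation (+-cong (*-cong w≈ φ≈) (+-cong a≈ (*-cong a≈ ψ≈))))

-- catRev lists the words backwards, last column first.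
lastR : List ℕ → ℕ
lastR []      = 0
lastR (h ∷ _) = suc h

isOdd-length-∷ʳ : ∀ (l : List ℕ) v → isOdd (length (l ∷ʳ v)) ≡ not (isOdd (length l))
isOdd-length-∷ʳ []      v = ≡.refl
isOdd-length-∷ʳ (w ∷ l) v = ≡.cong not (isOdd-length-∷ʳ l v)

oddCells-∷ʳ  : ∀ l v → oddCells (l ∷ʳ v) ≡ oddCells l ℕ.+ (if isOdd (length l) then 0 else suc v)
evenCells-∷ʳ : ∀ l v → evenCells (l ∷ʳ v) ≡ evenCells l ℕ.+ (if isOdd (length l) then suc v else 0)
oddCells-∷ʳ [] v = ℕ.+-identityʳ (suc v)
oddCells-∷ʳ (w ∷ l) v with isOdd (length l) | evenCells-∷ʳ l v
... | true  | eq = ≡.trans (≡.cong (suc w ℕ.+_) eq) (≡.sym (ℕ.+-assoc (suc w) (evenCells l) _))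
... | false | eq = ≡.trans (≡.cong (suc w ℕ.+_) eq) (≡.sym (ℕ.+-assoc (suc w) (evenCells l) _))
evenCells-∷ʳ []      v = ≡.refl
evenCells-∷ʳ (w ∷ l) v with isOdd (length l) | oddCells-∷ʳ l v
... | true  | eq = eq
... | false | eq = eq

s-∷ʳ : ∀ l v → s (l ∷ʳ v) ≡ suc v ℕ.+ sbar l
s-∷ʳ l v rewrite isOdd-length-∷ʳ l v | oddCells-∷ʳ l v | evenCells-∷ʳ l v with isOdd (length l)
... | true  = ℕ.+-comm (evenCells l) (suc v)
... | false = ℕ.+-comm (oddCells l) (suc v)

sbar-∷ʳ : ∀ l v → sbar (l ∷ʳ v) ≡ s l
sbar-∷ʳ l v rewrite isOdd-length-∷ʳ l v | oddCells-∷ʳ l v | evenCells-∷ʳ l v with isOdd (length l)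
... | true  = ℕ.+-identityʳ (oddCells l)
... | false = ℕ.+-identityʳ (evenCells l)

lastCol-∷ʳ : ∀ l v → lastCol (l ∷ʳ v) ≡ suc v
lastCol-∷ʳ []          v = ≡.refl
lastCol-∷ʳ (w ∷ [])    v = ≡.refl
lastCol-∷ʳ (w ∷ x ∷ l) v = lastCol-∷ʳ (x ∷ l) v

s-reverse    : ∀ r → s (reverse r) ≡ oddCells r
sbar-reverse : ∀ r → sbar (reverse r) ≡ evenCells r
s-reverse []      = ≡.refl
s-reverse (h ∷ t) rewrite unfold-reverse h t = ≡.trans (s-∷ʳ (reverse t) h) (≡.cong (suc h ℕ.+_) (sbar-reverse t))
sbar-reverse []      = ≡.refl
sbar-reverse (h ∷ t) rewrite unfold-reverse h t = ≡.trans (sbar-∷ʳ (reverse t) h) (s-reverse t)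

lastCol-reverse : ∀ r → lastCol (reverse r) ≡ lastR r
lastCol-reverse []      = ≡.refl
lastCol-reverse (h ∷ t) rewrite unfold-reverse h t = lastCol-∷ʳ (reverse t) h


ℤ-ring : CommutativeRing 0ℓ 0ℓ
ℤ-ring = ℤ.+-*-commutativeRing

-- PS = ℤ[[u]][[z]][[y]][[x]]: Sₖ has the last k of the variables x, y, z, u.
module S₁ = PowerSeries ℤ-ring
module S₂ = PowerSeries S₁.commutativeRing
module S₃ = PowerSeries S₂.commutativeRing
module S₄ = PowerSeries S₃.commutativeRing
module R₁ = CommutativeRing S₁.commutativeRing
module R₂ = CommutativeRing S₂.commutativeRing
module R₃ = CommutativeRing S₃.commutativeRing

open import Algebra.Properties.Semiring.Sum (CommutativeRing.semiring ℤ-ring)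
  using (sum; sum-syntax; sum-cong-≗; sum-init-last; sum-replicate-zero; ∑-comm)

sumTo-cong : ∀ n {f g : ℕ → ℤ} → (∀ i → f i ≡ g i) → sumTo n f ≡ sumTo n g
sumTo-cong zero    f≗g = ≡.refl
sumTo-cong (suc n) f≗g = ≡.cong₂ _+ℤ_ (sumTo-cong n f≗g) (f≗g n)

sumTo≡∑ : ∀ n (f : ℕ → ℤ) → sumTo n f ≡ ∑[ i < n ] f (toℕ i)
sumTo≡∑ zero    f = ≡.refl
sumTo≡∑ (suc n) f = begin
  sumTo n f +ℤ f n                                   ≡⟨ ≡.cong (_+ℤ f n) (sumTo≡∑ n f) ⟩
  ∑[ i < n ] f (toℕ i) +ℤ f n                      ≡⟨ ≡.cong₂ _+ℤ_ (sum-cong-≗ {n} {x = λ i → f (toℕ (inject₁ i))} (λ i → ≡.cong f (toℕ-inject₁ i)))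
                                                                 (≡.cong f (toℕ-fromℕ n)) ⟨
  ∑[ i < n ] f (toℕ (inject₁ i)) +ℤ f (toℕ (fromℕ n))  ≡⟨ sum-init-last {n} (λ i → f (toℕ i)) ⟨
  ∑[ i < suc n ] f (toℕ i)                          ∎
  where open ≡.≡-Reasoning

sumTo-comm : ∀ m n (h : ℕ → ℕ → ℤ) → sumTo m (λ i → sumTo n (h i)) ≡ sumTo n (λ j → sumTo m (λ i → h i j))
sumTo-comm m n h = begin
  sumTo m (λ i → sumTo n (h i))                        ≡⟨ sumTo-cong m (λ i → sumTo≡∑ n (h i)) ⟩
  sumTo m (λ i → ∑[ j < n ] h i (toℕ j))               ≡⟨ sumTo≡∑ m (λ i → ∑[ j < n ] h i (toℕ j)) ⟩
  ∑[ i < m ] ∑[ j < n ] h (toℕ i) (toℕ j)              ≡⟨ ∑-comm {m} {n} (λ i j → h (toℕ i) (toℕ j)) ⟩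
  ∑[ j < n ] ∑[ i < m ] h (toℕ i) (toℕ j)              ≡⟨ sumTo≡∑ n (λ j → ∑[ i < m ] h (toℕ i) j) ⟨
  sumTo n (λ j → ∑[ i < m ] h (toℕ i) j)               ≡⟨ sumTo-cong n (λ j → sumTo≡∑ m (λ i → h i j)) ⟨
  sumTo n (λ j → sumTo m (λ i → h i j))                ∎
  where open ≡.≡-Reasoning

*₁-coefficient : ∀ (f g : S₁.Series) d → (f S₁.*ₛ g) d ≡ sumTo (suc d) (λ l → f l *ℤ g (d ∸ l))
*₁-coefficient f g d = ≡.sym (sumTo≡∑ (suc d) _)

*₂-coefficient : ∀ (f g : S₂.Series) c d →
  (f S₂.*ₛ g) c d ≡ sumTo (suc c) (λ k → sumTo (suc d) (λ l → f k l *ℤ g (c ∸ k) (d ∸ l)))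
*₂-coefficient f g c d = ≡.trans (S₁.sum-apply (S₂.convolution f g c) d)
  (≡.trans (≡.sym (sumTo≡∑ (suc c) (λ k → (f k S₁.*ₛ g (c ∸ k)) d)))
           (sumTo-cong (suc c) (λ k → *₁-coefficient (f k) (g (c ∸ k)) d)))

*₃-coefficient : ∀ (f g : S₃.Series) b c d →
  (f S₃.*ₛ g) b c d ≡
  sumTo (suc b) (λ j → sumTo (suc c) (λ k → sumTo (suc d) (λ l → f j k l *ℤ g (b ∸ j) (c ∸ k) (d ∸ l))))
*₃-coefficient f g b c d = ≡.trans (S₂.sum-apply (S₃.convolution f g b) c d)
  (≡.trans (S₁.sum-apply (λ j → S₃.convolution f g b j c) d)
  (≡.trans (≡.sym (sumTo≡∑ (suc b) (λ j → (f j S₂.*ₛ g (b ∸ j)) c d)))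
           (sumTo-cong (suc b) (λ j → *₂-coefficient (f j) (g (b ∸ j)) c d))))

⊗≡*ₛ : ∀ f g a b c d → (f ⊗ g) a b c d ≡ (f S₄.*ₛ g) a b c d
⊗≡*ₛ f g a b c d = ≡.sym (≡.trans (S₃.sum-apply (S₄.convolution f g a) b c d)
  (≡.trans (S₂.sum-apply (λ i → S₄.convolution f g a i b) c d)
  (≡.trans (S₁.sum-apply (λ i → S₄.convolution f g a i b c) d)
  (≡.trans (≡.sym (sumTo≡∑ (suc a) (λ i → (f i S₃.*ₛ g (a ∸ i)) b c d)))
           (sumTo-cong (suc a) (λ i → *₃-coefficient (f i) (g (a ∸ i)) b c d))))))

monomial₃ : ℕ → ℕ → ℕ → S₃.Series
monomial₃ b c d = S₃.monomial b (S₂.monomial c (S₁.monomial d (+ 1)))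

monomial₄ : ℕ → ℕ → ℕ → ℕ → PS
monomial₄ a b c d = S₄.monomial a (monomial₃ b c d)

monomial₃-apply : ∀ e₁ e₂ e₃ b c d →
  monomial₃ e₁ e₂ e₃ b c d ≡ (if (b ≡ᵇ e₁) ∧ ((c ≡ᵇ e₂) ∧ (d ≡ᵇ e₃)) then + 1 else + 0)
monomial₃-apply e₁ e₂ e₃ b c d with b ≡ᵇ e₁
... | false = ≡.refl
... | true  = monomial₂-apply
  where
  monomial₂-apply : S₂.monomial e₂ (S₁.monomial e₃ (+ 1)) c d ≡ (if (c ≡ᵇ e₂) ∧ (d ≡ᵇ e₃) then + 1 else + 0)
  monomial₂-apply with c ≡ᵇ e₂
  ... | false = ≡.refl
  ... | true  = ≡.refl

monomial₄-apply : ∀ e₁ e₂ e₃ e₄ a b c d →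
  monomial₄ e₁ e₂ e₃ e₄ a b c d ≡ (if (a ≡ᵇ e₁) ∧ ((b ≡ᵇ e₂) ∧ ((c ≡ᵇ e₃) ∧ (d ≡ᵇ e₄))) then + 1 else + 0)
monomial₄-apply e₁ e₂ e₃ e₄ a b c d with a ≡ᵇ e₁
... | false = ≡.refl
... | true  = monomial₃-apply e₂ e₃ e₄ b c d

one≈1ₛ : one S₄.≈ₛ S₄.1ₛ
one≈1ₛ a b c d = ≡.sym (monomial₄-apply 0 0 0 0 a b c d)

PS-ring : CommutativeRing 0ℓ 0ℓ
PS-ring = record
  { Carrier = PS
  ; _≈_ = S₄._≈ₛ_
  ; _+_ = _⊕_
  ; _*_ = _⊗_
  ; -_ = S₄.-ₛ_
  ; 0# = S₄.0ₛ
  ; 1# = one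
  ; isCommutativeRing = isCommutativeRing-with S₄.commutativeRing ⊗≡*ₛ one≈1ₛ
  }

monomial₃-*ₛ-monomial₃ : ∀ b c d b′ c′ d′ →
  monomial₃ b c d S₃.*ₛ monomial₃ b′ c′ d′ S₃.≈ₛ monomial₃ (b ℕ.+ b′) (c ℕ.+ c′) (d ℕ.+ d′)
monomial₃-*ₛ-monomial₃ b c d b′ c′ d′ n =
  R₂.trans (S₃.monomial-*ₛ-monomial b b′ _ _ n)
           (S₃.monomial-cong (b ℕ.+ b′) (λ m → R₁.trans (S₂.monomial-*ₛ-monomial c c′ _ _ m)
                                              (S₂.monomial-cong (c ℕ.+ c′) (S₁.monomial-*ₛ-monomial d d′ (+ 1) (+ 1)) m)) n)

open ListSum S₃.commutativeRing
module PS = CommutativeRing PS-ring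

wordSeries : (List ℕ → S₃.Series) → PS
wordSeries φ a = ∑ₗ (catRev a) φ

module _ where
  open CommutativeRing S₃.commutativeRing

  ∑ₗ-catRev-cong : ∀ n {φ ψ : List ℕ → S₃.Series} →
                   (∀ h t → φ (h ∷ t) ≈ ψ (h ∷ t)) → ∑ₗ (catRev (suc n)) φ ≈ ∑ₗ (catRev (suc n)) ψ
  ∑ₗ-catRev-cong zero    φ≈ψ = +-congʳ (φ≈ψ 0 [])
  ∑ₗ-catRev-cong (suc n) {φ} {ψ} φ≈ψ =
    trans (∑ₗ-concatMap extendRev (catRev (suc n)) φ)
          (trans (∑ₗ-cong (catRev (suc n)) extensions) (sym (∑ₗ-concatMap extendRev (catRev (suc n)) ψ)))
    where
    extensions : ∀ r → ∑ₗ (extendRev r) φ ≈ ∑ₗ (extendRev r) ψ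
    extensions []      = refl
    extensions (h ∷ t) = trans (reflexive (∑ₗ-map (λ v → v ∷ h ∷ t) (upTo (suc (suc h))) φ))
      (trans (∑ₗ-cong (upTo (suc (suc h))) (λ v → φ≈ψ v (h ∷ t)))
             (reflexive (≡.sym (∑ₗ-map (λ v → v ∷ h ∷ t) (upTo (suc (suc h))) ψ))))

  -- M r k is the weight of r extended by a last column of k cells; every cell contributes τ.
  module ColumnEquation (τ : S₃.Series) (M : List ℕ → ℕ → S₃.Series) (M-suc : ∀ r k → M r (suc k) ≈ τ * M r k) where

    xτ τ̂ : PS
    xτ = S₄.monomial 1 τ
    τ̂  = S₄.monomial 0 τ

    τ̂-⊗ : ∀ f n → (τ̂ ⊗ f) n ≈ τ * f n
    τ̂-⊗ f n = trans (⊗≡*ₛ τ̂ f n) (S₄.monomial-*ₛ 0 τ f n)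

    x-⊗-zero : ∀ σ f → (S₄.monomial 1 σ ⊗ f) 0 ≈ 0#
    x-⊗-zero σ f = trans (⊗≡*ₛ (S₄.monomial 1 σ) f 0) (S₄.monomial-*ₛ 1 σ f 0)

    x-⊗-suc : ∀ σ f n → (S₄.monomial 1 σ ⊗ f) (suc n) ≈ σ * f n
    x-⊗-suc σ f n = trans (⊗≡*ₛ (S₄.monomial 1 σ) f (suc n)) (S₄.monomial-*ₛ 1 σ f (suc n))

    xτ⊗τ̂ : xτ ⊗ τ̂ PS.≈ S₄.monomial 1 (τ * τ)
    xτ⊗τ̂ = PS.trans (⊗≡*ₛ xτ τ̂) (S₄.monomial-*ₛ-monomial 1 0 τ τ)

    module _ {φ ψ ψ′ : List ℕ → S₃.Series}
             (φ-first : φ (0 ∷ []) ≈ τ)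
             (φ-∷ : ∀ v h t → φ (v ∷ h ∷ t) ≈ M (h ∷ t) (suc v))
             (ψ-∷ : ∀ h t → ψ (h ∷ t) ≈ M (h ∷ t) 0)
             (ψ′-∷ : ∀ h t → ψ′ (h ∷ t) ≈ M (h ∷ t) (suc h)) where

      Φ Ψ Ψ′ : PS
      Φ  = wordSeries φ
      Ψ  = wordSeries ψ
      Ψ′ = wordSeries ψ′

      extension : List ℕ → S₃.Series
      extension r = ∑ₗ (extendRev r) φ

      extension≈ : ∀ h t → extension (h ∷ t) ≈ ∑ₗ (upTo (suc (suc h))) (λ v → M (h ∷ t) (suc v))
      extension≈ h t = trans (reflexive (∑ₗ-map (λ v → v ∷ h ∷ t) (upTo (suc (suc h))) φ))
                             (∑ₗ-cong (upTo (suc (suc h))) (λ v → φ-∷ v h t))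

      M-suc² : ∀ r k → τ * τ * M r k ≈ M r (suc (suc k))
      M-suc² r k = trans (*-assoc τ τ (M r k)) (sym (trans (M-suc r (suc k)) (*-congˡ {τ} (M-suc r k))))

      τ*∑ₗ : ∀ r N → τ * ∑ₗ (upTo N) (λ v → M r (suc v)) ≈ ∑ₗ (upTo N) (λ v → M r (suc (suc v)))
      τ*∑ₗ r N = trans (*-distribˡ-∑ₗ τ (upTo N) (λ v → M r (suc v))) (∑ₗ-cong (upTo N) (λ v → sym (M-suc r (suc v))))

      -- Appending a last column of height v + 1 multiplies the weight by τ^(v+1); the sum over v telescopes.
      one-word : ∀ h t → extension (h ∷ t) + τ * τ * ψ′ (h ∷ t) ≈ τ * extension (h ∷ t) + τ * ψ (h ∷ t)
      one-word h t = begin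
        extension r + τ * τ * ψ′ r                 ≈⟨ +-cong (extension≈ h t) (trans (*-congˡ {τ * τ} (ψ′-∷ h t)) (M-suc² r (suc h))) ⟩
        ∑ₗ (upTo N) g + g N                        ≈⟨ ∑ₗ-upTo-telescope N g ⟩
        g 0 + ∑ₗ (upTo N) (λ v → g (suc v))        ≈⟨ +-comm (g 0) _ ⟩
        ∑ₗ (upTo N) (λ v → g (suc v)) + g 0        ≈⟨ +-cong (sym (trans (*-congˡ {τ} (extension≈ h t)) (τ*∑ₗ r N)))
                                                             (sym (trans (*-congˡ {τ} (ψ-∷ h t)) (sym (M-suc r 0)))) ⟩
        τ * extension r + τ * ψ r                  ∎
        where
        open SetoidReasoning setoid
        r = h ∷ t
        N = suc (suc h)
        g : ℕ → S₃.Series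
        g v = M r (suc v)

      column-equation : Φ ⊕ (xτ ⊗ τ̂ ⊕ xτ ⊗ τ̂ ⊗ Ψ′) PS.≈ τ̂ ⊗ Φ ⊕ (xτ ⊕ xτ ⊗ Ψ)
      column-equation zero = begin
        0# + ((xτ ⊗ τ̂) 0 + (xτ ⊗ τ̂ ⊗ Ψ′) 0)
          ≈⟨ +-congˡ {0#} (+-cong (xτ⊗τ̂ 0) (trans (PS.*-cong xτ⊗τ̂ (PS.refl {Ψ′}) 0) (x-⊗-zero (τ * τ) Ψ′))) ⟩
        0# + (0# + 0#)                            ≈⟨ +-congʳ {0# + 0#} (trans (sym (zeroʳ τ)) (sym (τ̂-⊗ Φ 0))) ⟩
        (τ̂ ⊗ Φ) 0 + (0# + 0#)                     ≈⟨ +-congˡ {(τ̂ ⊗ Φ) 0} (+-congˡ {0#} (sym (x-⊗-zero τ Ψ))) ⟩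
        (τ̂ ⊗ Φ) 0 + (0# + (xτ ⊗ Ψ) 0)             ∎
        where open SetoidReasoning setoid
      column-equation (suc zero) = begin
        (φ (0 ∷ []) + 0#) + ((xτ ⊗ τ̂) 1 + (xτ ⊗ τ̂ ⊗ Ψ′) 1)  ≈⟨ +-cong (trans (+-identityʳ (φ (0 ∷ []))) φ-first)
                                                                (+-cong (xτ⊗τ̂ 1) (trans (PS.*-cong xτ⊗τ̂ (PS.refl {Ψ′}) 1)
                                                                                         (trans (x-⊗-suc (τ * τ) Ψ′ 0) (zeroʳ (τ * τ))))) ⟩
        τ + (τ * τ + 0#)                                     ≈⟨ trans (+-congˡ {τ} (+-identityʳ (τ * τ))) (+-comm τ (τ * τ)) ⟩
        τ * τ + τ                                            ≈⟨ +-cong (sym (trans (τ̂-⊗ Φ 1) (*-congˡ {τ} (trans (+-identityʳ (φ (0 ∷ []))) φ-first))))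
                                                                       (sym (trans (+-congˡ {τ} (trans (x-⊗-suc τ Ψ 0) (zeroʳ τ))) (+-identityʳ τ))) ⟩
        (τ̂ ⊗ Φ) 1 + (τ + (xτ ⊗ Ψ) 1)                         ∎
        where open SetoidReasoning setoid
      column-equation (suc (suc m)) = begin
        Φ (suc (suc m)) + ((xτ ⊗ τ̂) (suc (suc m)) + (xτ ⊗ τ̂ ⊗ Ψ′) (suc (suc m)))
          ≈⟨ +-cong (∑ₗ-concatMap extendRev (catRev (suc m)) φ)
                    (trans (+-cong (xτ⊗τ̂ (suc (suc m))) (trans (PS.*-cong xτ⊗τ̂ (PS.refl {Ψ′}) (suc (suc m))) (x-⊗-suc (τ * τ) Ψ′ (suc m))))
                           (trans (+-identityˡ ((τ * τ) * Ψ′ (suc m))) (*-distribˡ-∑ₗ (τ * τ) (catRev (suc m)) ψ′))) ⟩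
        ∑ₗ words extension + ∑ₗ words (λ r → τ * τ * ψ′ r)
          ≈⟨ sym (∑ₗ-+ words extension (λ r → τ * τ * ψ′ r)) ⟩
        ∑ₗ words (λ r → extension r + τ * τ * ψ′ r)
          ≈⟨ ∑ₗ-catRev-cong m {λ r → extension r + τ * τ * ψ′ r} {λ r → τ * extension r + τ * ψ r} one-word ⟩
        ∑ₗ words (λ r → τ * extension r + τ * ψ r)
          ≈⟨ ∑ₗ-+ words (λ r → τ * extension r) (λ r → τ * ψ r) ⟩
        ∑ₗ words (λ r → τ * extension r) + ∑ₗ words (λ r → τ * ψ r)
          ≈⟨ +-cong (trans (sym (*-distribˡ-∑ₗ τ words extension))
                           (trans (*-congˡ {τ} (sym (∑ₗ-concatMap extendRev words φ))) (sym (τ̂-⊗ Φ (suc (suc m))))))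
                    (sym (trans (+-identityˡ _) (trans (x-⊗-suc τ Ψ (suc m)) (*-distribˡ-∑ₗ τ words ψ)))) ⟩
        (τ̂ ⊗ Φ) (suc (suc m)) + (0# + (xτ ⊗ Ψ) (suc (suc m)))  ∎
        where
        open SetoidReasoning setoid
        words = catRev (suc m)

open CommutativeRing PS-ring
  using (_≈_; refl; sym; trans; setoid; 0#; +-cong; +-congˡ; -‿cong; *-cong; *-congˡ; *-congʳ; +-identityˡ; *-identityˡ)
module ≈-Reasoning = SetoidReasoning setoid

monomial₄-⊗-monomial₄ : ∀ a b c d a′ b′ c′ d′ →
          monomial₄ a b c d ⊗ monomial₄ a′ b′ c′ d′ ≈ monomial₄ (a ℕ.+ a′) (b ℕ.+ b′) (c ℕ.+ c′) (d ℕ.+ d′)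
monomial₄-⊗-monomial₄ a b c d a′ b′ c′ d′ =
  trans (⊗≡*ₛ (monomial₄ a b c d) (monomial₄ a′ b′ c′ d′))
        (trans (S₄.monomial-*ₛ-monomial a a′ (monomial₃ b c d) (monomial₃ b′ c′ d′))
               (S₄.monomial-cong (a ℕ.+ a′) (monomial₃-*ₛ-monomial₃ b c d b′ c′ d′)))

X≈ : X ≈ monomial₄ 1 0 0 0
X≈ a b c d = ≡.sym (monomial₄-apply 1 0 0 0 a b c d)

Y≈ : Y ≈ monomial₄ 0 1 0 0
Y≈ a b c d = ≡.sym (monomial₄-apply 0 1 0 0 a b c d)

Z≈ : Z ≈ monomial₄ 0 0 1 0
Z≈ a b c d = ≡.sym (monomial₄-apply 0 0 1 0 a b c d)

U≈ : U ≈ monomial₄ 0 0 0 1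
U≈ a b c d = ≡.sym (monomial₄-apply 0 0 0 1 a b c d)

-- rotate moves u to the front, so that u becomes the outermost variable of S₄
rotate : PS → PS
rotate f d a b c = f a b c d

rotate-injective : ∀ {f g} → rotate f ≈ rotate g → f ≈ g
rotate-injective eq a b c d = eq d a b c

rotate-⊗ : ∀ f g → rotate (f ⊗ g) ≈ rotate f ⊗ rotate g
rotate-⊗ f g d a b c = begin
  sumTo (suc a) (λ i → sumTo (suc b) (λ j → sumTo (suc c) (λ k → sumTo (suc d) (summand i j k))))
    ≡⟨ sumTo-cong (suc a) (λ i → sumTo-cong (suc b) (λ j → sumTo-comm (suc c) (suc d) (summand i j))) ⟩
  sumTo (suc a) (λ i → sumTo (suc b) (λ j → sumTo (suc d) (λ l → sumTo (suc c) (λ k → summand i j k l))))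
    ≡⟨ sumTo-cong (suc a) (λ i → sumTo-comm (suc b) (suc d) (λ j l → sumTo (suc c) (λ k → summand i j k l))) ⟩
  sumTo (suc a) (λ i → sumTo (suc d) (λ l → sumTo (suc b) (λ j → sumTo (suc c) (λ k → summand i j k l))))
    ≡⟨ sumTo-comm (suc a) (suc d) (λ i l → sumTo (suc b) (λ j → sumTo (suc c) (λ k → summand i j k l))) ⟩
  sumTo (suc d) (λ l → sumTo (suc a) (λ i → sumTo (suc b) (λ j → sumTo (suc c) (λ k → summand i j k l))))
    ∎
  where
  open ≡.≡-Reasoning
  summand : ℕ → ℕ → ℕ → ℕ → ℤ
  summand i j k l = f i j k l *ℤ g (a ∸ i) (b ∸ j) (c ∸ k) (d ∸ l)

∧-rotate : ∀ w x y z → w ∧ (x ∧ (y ∧ z)) ≡ z ∧ (w ∧ (x ∧ y))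
∧-rotate w x y true  rewrite ∧-identityʳ y = ≡.refl
∧-rotate w x y false rewrite ∧-zeroʳ y | ∧-zeroʳ x | ∧-zeroʳ w = ≡.refl

rotate-monomial₄ : ∀ a b c d → rotate (monomial₄ a b c d) ≈ monomial₄ d a b c
rotate-monomial₄ a b c d d′ a′ b′ c′ = ≡.trans (monomial₄-apply a b c d a′ b′ c′ d′)
  (≡.trans (≡.cong (λ x → if x then + 1 else + 0) (∧-rotate (a′ ≡ᵇ a) (b′ ≡ᵇ b) (c′ ≡ᵇ c) (d′ ≡ᵇ d)))
           (≡.sym (monomial₄-apply d a b c d′ a′ b′ c′)))

rotate-one : rotate one ≈ one
rotate-one = trans (λ d a b c → one≈1ₛ a b c d) (trans (rotate-monomial₄ 0 0 0 0) (sym one≈1ₛ))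

monomial₃-^ₛ : ∀ b c d k → monomial₃ b c d S₃.^ₛ k S₃.≈ₛ monomial₃ (k ℕ.* b) (k ℕ.* c) (k ℕ.* d)
monomial₃-^ₛ b c d k = R₃.trans (S₃.monomial-^ₛ b _ k) (S₃.monomial-cong (k ℕ.* b)
  (R₂.trans (S₂.monomial-^ₛ c _ k) (S₂.monomial-cong (k ℕ.* c)
  (R₁.trans (S₁.monomial-^ₛ d (+ 1) k) (S₁.monomial-cong (k ℕ.* d) (S₁.1#^n≈1# k))))))

monomial₃-*ₛ : ∀ e₁ e₂ e₃ h b c d → (monomial₃ e₁ e₂ e₃ S₃.*ₛ h) b c d ≡
        (if (e₁ ≤ᵇ b) ∧ ((e₂ ≤ᵇ c) ∧ (e₃ ≤ᵇ d)) then h (b ∸ e₁) (c ∸ e₂) (d ∸ e₃) else + 0)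
monomial₃-*ₛ e₁ e₂ e₃ h b c d = ≡.trans (S₃.monomial-*ₛ e₁ _ h b c d) level₃
  where
  level₁ : ∀ (g : S₁.Series) → (S₁.monomial e₃ (+ 1) S₁.*ₛ g) d ≡ (if e₃ ≤ᵇ d then g (d ∸ e₃) else + 0)
  level₁ g with e₃ ≤ᵇ d | S₁.monomial-*ₛ e₃ (+ 1) g d
  ... | true  | eq = ≡.trans eq (ℤ.*-identityˡ _)
  ... | false | eq = eq
  level₂ : ∀ (g : S₂.Series) → (S₂.monomial e₂ (S₁.monomial e₃ (+ 1)) S₂.*ₛ g) c d ≡
                               (if (e₂ ≤ᵇ c) ∧ (e₃ ≤ᵇ d) then g (c ∸ e₂) (d ∸ e₃) else + 0)
  level₂ g with e₂ ≤ᵇ c | S₂.monomial-*ₛ e₂ (S₁.monomial e₃ (+ 1)) g c d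
  ... | true  | eq = ≡.trans eq (level₁ (g (c ∸ e₂)))
  ... | false | eq = eq
  level₃ : (if e₁ ≤ᵇ b then S₂.monomial e₂ (S₁.monomial e₃ (+ 1)) S₂.*ₛ h (b ∸ e₁) else R₂.0#) c d ≡
           (if (e₁ ≤ᵇ b) ∧ ((e₂ ≤ᵇ c) ∧ (e₃ ≤ᵇ d)) then h (b ∸ e₁) (c ∸ e₂) (d ∸ e₃) else + 0)
  level₃ with e₁ ≤ᵇ b
  ... | true  = level₂ (h (b ∸ e₁))
  ... | false = ≡.refl

-- substitute p r f = f(x, y, z, yᵖ zʳ u); substQ k is substitute k k.
substitute₃ : ℕ → ℕ → S₃.Series → S₃.Series
substitute₃ p r g b c d = if (p ℕ.* d ≤ᵇ b) ∧ (r ℕ.* d ≤ᵇ c) then g (b ∸ p ℕ.* d) (c ∸ r ℕ.* d) d else + 0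

substitute : ℕ → ℕ → PS → PS
substitute p r f a = substitute₃ p r (f a)

rotate-substitute : ∀ p r f → rotate (substitute p r f) ≈ S₄.twist (monomial₃ 0 p r) (rotate f)
rotate-substitute p r f d a b c = ≡.sym (≡.trans (S₃.*ₛ-cong {g = rotate f d} {g′ = rotate f d} (monomial₃-^ₛ 0 p r d) (λ _ → R₂.refl) a b c)
  (≡.trans (monomial₃-*ₛ (d ℕ.* 0) (d ℕ.* p) (d ℕ.* r) (rotate f d) a b c) reorder))
  where
  reorder : (if (d ℕ.* 0 ≤ᵇ a) ∧ ((d ℕ.* p ≤ᵇ b) ∧ (d ℕ.* r ≤ᵇ c))
             then f (a ∸ d ℕ.* 0) (b ∸ d ℕ.* p) (c ∸ d ℕ.* r) d else + 0) ≡ substitute p r f a b c d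
  reorder rewrite ℕ.*-zeroʳ d | ℕ.*-comm d p | ℕ.*-comm d r = ≡.refl

substitute-⊗ : ∀ p r f g → substitute p r (f ⊗ g) ≈ substitute p r f ⊗ substitute p r g
substitute-⊗ p r f g = rotate-injective (begin
  rotate (substitute p r (f ⊗ g))                   ≈⟨ rotate-substitute p r (f ⊗ g) ⟩
  S₄.twist t (rotate (f ⊗ g))                       ≈⟨ S₄.twist-cong R₃.refl (trans (rotate-⊗ f g) (⊗≡*ₛ (rotate f) (rotate g))) ⟩
  S₄.twist t (rotate f S₄.*ₛ rotate g)              ≈⟨ S₄.twist-*ₛ t (rotate f) (rotate g) ⟩
  S₄.twist t (rotate f) S₄.*ₛ S₄.twist t (rotate g) ≈⟨ S₄.*ₛ-cong (rotate-substitute p r f) (rotate-substitute p r g) ⟨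
  rotate (f′) S₄.*ₛ rotate (g′)                     ≈⟨ trans (rotate-⊗ f′ g′) (⊗≡*ₛ (rotate f′) (rotate g′)) ⟨
  rotate (f′ ⊗ g′)                                  ∎)
  where
  open ≈-Reasoning
  t = monomial₃ 0 p r
  f′ = substitute p r f
  g′ = substitute p r g

substitute-⊕ : ∀ p r f g → substitute p r (f ⊕ g) ≈ substitute p r f ⊕ substitute p r g
substitute-⊕ p r f g a b c d with (p ℕ.* d ≤ᵇ b) ∧ (r ℕ.* d ≤ᵇ c)
... | true  = ≡.refl
... | false = ≡.refl

substitute-cong : ∀ p r {f g} → f ≈ g → substitute p r f ≈ substitute p r g
substitute-cong p r f≈g a b c d with (p ℕ.* d ≤ᵇ b) ∧ (r ℕ.* d ≤ᵇ c)
... | true  = f≈g _ _ _ _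
... | false = ≡.refl

substitute-substitute : ∀ p r p′ r′ f → substitute p r (substitute p′ r′ f) ≈ substitute (p ℕ.+ p′) (r ℕ.+ r′) f
substitute-substitute p r p′ r′ f = rotate-injective (begin
  rotate (substitute p r (substitute p′ r′ f))          ≈⟨ rotate-substitute p r (substitute p′ r′ f) ⟩
  S₄.twist (monomial₃ 0 p r) (rotate (substitute p′ r′ f))     ≈⟨ S₄.twist-cong R₃.refl (rotate-substitute p′ r′ f) ⟩
  S₄.twist (monomial₃ 0 p r) (S₄.twist (monomial₃ 0 p′ r′) (rotate f)) ≈⟨ S₄.twist-twist (monomial₃ 0 p r) (monomial₃ 0 p′ r′) (rotate f) ⟩
  S₄.twist (monomial₃ 0 p r S₃.*ₛ monomial₃ 0 p′ r′) (rotate f)        ≈⟨ S₄.twist-cong (monomial₃-*ₛ-monomial₃ 0 p r 0 p′ r′) (λ _ → R₃.refl) ⟩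
  S₄.twist (monomial₃ 0 (p ℕ.+ p′) (r ℕ.+ r′)) (rotate f)       ≈⟨ rotate-substitute (p ℕ.+ p′) (r ℕ.+ r′) f ⟨
  rotate (substitute (p ℕ.+ p′) (r ℕ.+ r′) f)            ∎)
  where open ≈-Reasoning

substitute-vanishesBelow : ∀ p r k {f} → S₄.VanishesBelow k f → S₄.VanishesBelow k (substitute p r f)
substitute-vanishesBelow p r k f≈0 a a<k b c d with (p ℕ.* d ≤ᵇ b) ∧ (r ℕ.* d ≤ᵇ c)
... | true  = f≈0 a a<k _ _ _
... | false = ≡.refl

substitute-monomial₄ : ∀ p r a b c d → substitute p r (monomial₄ a b c d) ≈ monomial₄ a (p ℕ.* d ℕ.+ b) (r ℕ.* d ℕ.+ c) d
substitute-monomial₄ p r a b c d = rotate-injective (begin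
  rotate (substitute p r (monomial₄ a b c d))              ≈⟨ rotate-substitute p r (monomial₄ a b c d) ⟩
  S₄.twist t (rotate (monomial₄ a b c d))                  ≈⟨ S₄.twist-cong R₃.refl (rotate-monomial₄ a b c d) ⟩
  S₄.twist t (S₄.monomial d (monomial₃ a b c))                ≈⟨ S₄.twist-monomial t d (monomial₃ a b c) ⟩
  S₄.monomial d (t S₃.^ₛ d S₃.*ₛ monomial₃ a b c)             ≈⟨ S₄.monomial-cong d (R₃.trans (S₃.*ₛ-cong (monomial₃-^ₛ 0 p r d) (λ _ → R₂.refl))
                                                                                    (monomial₃-*ₛ-monomial₃ (d ℕ.* 0) (d ℕ.* p) (d ℕ.* r) a b c)) ⟩
  monomial₄ d (d ℕ.* 0 ℕ.+ a) (d ℕ.* p ℕ.+ b) (d ℕ.* r ℕ.+ c) ≈⟨ reflexive-monomial₄ ⟩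
  monomial₄ d a (p ℕ.* d ℕ.+ b) (r ℕ.* d ℕ.+ c)            ≈⟨ rotate-monomial₄ a (p ℕ.* d ℕ.+ b) (r ℕ.* d ℕ.+ c) d ⟨
  rotate (monomial₄ a (p ℕ.* d ℕ.+ b) (r ℕ.* d ℕ.+ c) d)   ∎)
  where
  open ≈-Reasoning
  t = monomial₃ 0 p r
  reflexive-monomial₄ : monomial₄ d (d ℕ.* 0 ℕ.+ a) (d ℕ.* p ℕ.+ b) (d ℕ.* r ℕ.+ c) ≈ monomial₄ d a (p ℕ.* d ℕ.+ b) (r ℕ.* d ℕ.+ c)
  reflexive-monomial₄ rewrite ℕ.*-zeroʳ d | ℕ.*-comm d p | ℕ.*-comm d r = refl

pow≈^ₛ : ∀ f k → pow f k ≈ f S₄.^ₛ k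
pow≈^ₛ f zero    = one≈1ₛ
pow≈^ₛ f (suc k) =
  trans (⊗≡*ₛ (pow f k) f) (trans (S₄.*ₛ-cong (pow≈^ₛ f k) (λ _ → R₃.refl)) (S₄.*ₛ-comm (f S₄.^ₛ k) f))

rotate-pow : ∀ f k → rotate (pow f k) ≈ pow (rotate f) k
rotate-pow f zero    = rotate-one
rotate-pow f (suc k) = trans (rotate-⊗ (pow f k) f) (*-cong (rotate-pow f k) (refl {x = rotate f}))

∑-select : ∀ N d (h : ℕ → ℤ) → d < N → ∑[ k < N ] (if d ≡ᵇ toℕ k then h (toℕ k) else + 0) ≡ h d
∑-select (suc N) zero    h _         = ≡.trans (≡.cong (h 0 +ℤ_) (sum-replicate-zero N)) (ℤ.+-identityʳ _)
∑-select (suc N) (suc d) h (s≤s d<N) = ≡.trans (ℤ.+-identityˡ _) (∑-select N d (λ k → h (suc k)) d<N)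

sumTo-select : ∀ N d (h : ℕ → ℤ) → d < N → sumTo N (λ k → if d ≡ᵇ k then h k else + 0) ≡ h d
sumTo-select N d h d<N = ≡.trans (sumTo≡∑ N _) (∑-select N d h d<N)

rotate-inv1m : ∀ w t → rotate w ≈ S₄.monomial 1 t → rotate (inv1m w) ≈ S₄.geometric t
rotate-inv1m w t rw d a b c =
  ≡.trans (sumTo-cong (suc (a ℕ.+ b ℕ.+ c ℕ.+ d)) powerCoefficient) (sumTo-select _ d _ (s≤s (ℕ.m≤n+m d (a ℕ.+ b ℕ.+ c))))
  where
  coefficient : ∀ k → S₄.monomial (k ℕ.* 1) (t S₃.^ₛ k) d a b c ≡ (if d ≡ᵇ k then (t S₃.^ₛ k) a b c else + 0)
  coefficient k rewrite ℕ.*-identityʳ k with d ≡ᵇ k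
  ... | true  = ≡.refl
  ... | false = ≡.refl
  powerCoefficient : ∀ k → pow w k a b c d ≡ (if d ≡ᵇ k then (t S₃.^ₛ k) a b c else + 0)
  powerCoefficient k = ≡.trans (rotate-pow w k d a b c) (≡.trans (pow≈^ₛ (rotate w) k d a b c)
           (≡.trans (S₄.^ₛ-congˡ k rw d a b c) (≡.trans (S₄.monomial-^ₛ 1 t k d a b c) (coefficient k))))

inv1m-inverse : ∀ w t → rotate w ≈ S₄.monomial 1 t → (one ⊖ w) ⊗ inv1m w ≈ one
inv1m-inverse w t rw = rotate-injective (begin
  rotate ((one ⊖ w) ⊗ inv1m w)                    ≈⟨ rotate-⊗ (one ⊖ w) (inv1m w) ⟩
  rotate (one ⊖ w) ⊗ rotate (inv1m w)             ≈⟨ *-cong (+-cong rotate-one (-‿cong rw)) (rotate-inv1m w t rw) ⟩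
  (one ⊖ S₄.monomial 1 t) ⊗ S₄.geometric t        ≈⟨ ⊗≡*ₛ (one ⊖ S₄.monomial 1 t) (S₄.geometric t) ⟩
  (one ⊖ S₄.monomial 1 t) S₄.*ₛ S₄.geometric t    ≈⟨ S₄.*ₛ-cong {g = S₄.geometric t} {g′ = S₄.geometric t}
                                                                (+-cong one≈1ₛ (refl {x = S₄.-ₛ S₄.monomial 1 t})) (λ _ → R₃.refl) ⟩
  (S₄.1ₛ S₄.-ₛ S₄.monomial 1 t) S₄.*ₛ S₄.geometric t ≈⟨ S₄.geometric-inverse t ⟩
  S₄.1ₛ                                           ≈⟨ trans rotate-one one≈1ₛ ⟨
  rotate one                                      ∎)
  where open ≈-Reasoning

≡ᵇ-comm : ∀ m n → (m ≡ᵇ n) ≡ (n ≡ᵇ m)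
≡ᵇ-comm zero    zero    = ≡.refl
≡ᵇ-comm zero    (suc n) = ≡.refl
≡ᵇ-comm (suc m) zero    = ≡.refl
≡ᵇ-comm (suc m) (suc n) = ≡ᵇ-comm m n

monomial₃-cong : ∀ {e₁ e₂ e₃ e₁′ e₂′ e₃′} → e₁ ≡ e₁′ → e₂ ≡ e₂′ → e₃ ≡ e₃′ → monomial₃ e₁ e₂ e₃ ≡ monomial₃ e₁′ e₂′ e₃′
monomial₃-cong ≡.refl ≡.refl ≡.refl = ≡.refl

count-step : ∀ x {n z} → + n ≡ z → + (if x then suc n else n) ≡ (if x then + 1 else + 0) +ℤ z
count-step true  n≡z = ≡.cong (+ 1 +ℤ_) n≡z
count-step false n≡z = ≡.trans n≡z (≡.sym (ℤ.+-identityˡ _))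

catSeries≈wordSeries : ∀ ey ez eu {ey′ ez′ eu′ : List ℕ → ℕ} →
  (∀ r → ey (reverse r) ≡ ey′ r) → (∀ r → ez (reverse r) ≡ ez′ r) → (∀ r → eu (reverse r) ≡ eu′ r) →
  catSeries ey ez eu ≈ wordSeries (λ r → monomial₃ (ey′ r) (ez′ r) (eu′ r))
catSeries≈wordSeries ey ez eu {ey′} {ez′} {eu′} ey≡ ez≡ eu≡ a b c d = ≡.trans
  (count≡∑ₗ (catWords a))
  (≡.cong (λ x → x b c d) (≡.trans (∑ₗ-map reverse (catRev a) weight) (reversed (catRev a))))
  where
  weight : List ℕ → S₃.Series
  weight w = monomial₃ (ey w) (ez w) (eu w)
  reversed : ∀ rs → ∑ₗ rs (λ r → weight (reverse r)) ≡ ∑ₗ rs (λ r → monomial₃ (ey′ r) (ez′ r) (eu′ r))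
  reversed []       = ≡.refl
  reversed (r ∷ rs) = ≡.cong₂ S₃._+ₛ_ (monomial₃-cong (ey≡ r) (ez≡ r) (eu≡ r)) (reversed rs)
  count≡∑ₗ : ∀ ws → + countB (λ w → (ey w ≡ᵇ b) ∧ ((ez w ≡ᵇ c) ∧ (eu w ≡ᵇ d))) ws ≡ ∑ₗ ws weight b c d
  count≡∑ₗ []       = ≡.refl
  count≡∑ₗ (w ∷ ws) = ≡.trans (count-step _ (count≡∑ₗ ws)) (≡.cong (_+ℤ ∑ₗ ws weight b c d) (≡.sym (≡.trans
    (monomial₃-apply (ey w) (ez w) (eu w) b c d)
    (≡.cong (λ x → if x then + 1 else + 0)
          (≡.cong₂ _∧_ (≡ᵇ-comm b (ey w)) (≡.cong₂ _∧_ (≡ᵇ-comm c (ez w)) (≡ᵇ-comm d (eu w))))))))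


F≈ : F ≈ wordSeries (λ r → monomial₃ (oddCells r) (evenCells r) (lastR r))
F≈ = catSeries≈wordSeries s sbar lastCol s-reverse sbar-reverse lastCol-reverse

G≈ : G ≈ wordSeries (λ r → monomial₃ (evenCells r) (oddCells r) (lastR r))
G≈ = catSeries≈wordSeries sbar s lastCol sbar-reverse s-reverse lastCol-reverse

F1≈ : F1 ≈ wordSeries (λ r → monomial₃ (oddCells r) (evenCells r) 0)
F1≈ = catSeries≈wordSeries s sbar zeroU s-reverse sbar-reverse (λ _ → ≡.refl)

G1≈ : G1 ≈ wordSeries (λ r → monomial₃ (evenCells r) (oddCells r) 0)
G1≈ = catSeries≈wordSeries sbar s zeroU sbar-reverse s-reverse (λ _ → ≡.refl)


substitute₃-+ₛ : ∀ p q g h → substitute₃ p q (g S₃.+ₛ h) S₃.≈ₛ substitute₃ p q g S₃.+ₛ substitute₃ p q h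
substitute₃-+ₛ p q g h b c d with (p ℕ.* d ℕ.≤ᵇ b) ∧ (q ℕ.* d ℕ.≤ᵇ c)
... | true  = ≡.refl
... | false = ≡.refl

substitute₃-0ₛ : ∀ p q → substitute₃ p q S₃.0ₛ S₃.≈ₛ S₃.0ₛ
substitute₃-0ₛ p q b c d with (p ℕ.* d ℕ.≤ᵇ b) ∧ (q ℕ.* d ℕ.≤ᵇ c)
... | true  = ≡.refl
... | false = ≡.refl

substitute₃-∑ₗ : ∀ p q {A : Set} (xs : List A) φ →
  substitute₃ p q (∑ₗ xs φ) S₃.≈ₛ ∑ₗ xs (λ x → substitute₃ p q (φ x))
substitute₃-∑ₗ p q []       φ = substitute₃-0ₛ p q
substitute₃-∑ₗ p q (x ∷ xs) φ =
  R₃.trans (substitute₃-+ₛ p q (φ x) (∑ₗ xs φ)) (R₃.+-congˡ {substitute₃ p q (φ x)} (substitute₃-∑ₗ p q xs φ))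

substitute-wordSeries : ∀ p q (α β γ : List ℕ → ℕ) →
  substitute p q (wordSeries (λ r → monomial₃ (α r) (β r) (γ r))) ≈
  wordSeries (λ r → monomial₃ (p ℕ.* γ r ℕ.+ α r) (q ℕ.* γ r ℕ.+ β r) (γ r))
substitute-wordSeries p q α β γ a = R₃.trans (substitute₃-∑ₗ p q (catRev a) (λ r → monomial₃ (α r) (β r) (γ r)))
  (∑ₗ-cong (catRev a) (λ r → substitute-monomial₄ p q 0 (α r) (β r) (γ r) 0))

Gy≈ : substitute 1 0 G ≈ wordSeries (λ r → monomial₃ (lastR r ℕ.+ evenCells r) (oddCells r) (lastR r))
Gy≈ = trans (substitute-cong 1 0 G≈) (trans (substitute-wordSeries 1 0 evenCells oddCells lastR)
  (λ a → ∑ₗ-cong (catRev a) (λ r →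
    R₃.reflexive (monomial₃-cong (≡.cong (ℕ._+ evenCells r) (ℕ.*-identityˡ (lastR r))) ≡.refl ≡.refl))))

Fq≈ : substQ 1 F ≈ wordSeries (λ r → monomial₃ (lastR r ℕ.+ oddCells r) (lastR r ℕ.+ evenCells r) (lastR r))
Fq≈ = trans (substitute-cong 1 1 F≈) (trans (substitute-wordSeries 1 1 oddCells evenCells lastR)
  (λ a → ∑ₗ-cong (catRev a) (λ r → R₃.reflexive (monomial₃-cong (≡.cong (ℕ._+ oddCells r) (ℕ.*-identityˡ (lastR r)))
                                                          (≡.cong (ℕ._+ evenCells r) (ℕ.*-identityˡ (lastR r))) ≡.refl))))

-- Pointwise, so that constant (+ 1) is definitionally one.
constant : ℤ → PS
constant z a b c d = if (a ≡ᵇ 0) ∧ ((b ≡ᵇ 0) ∧ ((c ≡ᵇ 0) ∧ (d ≡ᵇ 0))) then z else + 0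

constant₃ : ℤ → S₃.Series
constant₃ z = S₃.monomial 0 (S₂.monomial 0 (S₁.monomial 0 z))

constant≈monomial : ∀ z → constant z ≈ S₄.monomial 0 (constant₃ z)
constant≈monomial z a b c d with a ≡ᵇ 0
... | false = ≡.refl
... | true  = level₃
  where
  level₂ : (if (c ≡ᵇ 0) ∧ (d ≡ᵇ 0) then z else + 0) ≡ S₂.monomial 0 (S₁.monomial 0 z) c d
  level₂ with c ≡ᵇ 0
  ... | false = ≡.refl
  ... | true  = ≡.refl
  level₃ : (if (b ≡ᵇ 0) ∧ ((c ≡ᵇ 0) ∧ (d ≡ᵇ 0)) then z else + 0) ≡ constant₃ z b c d
  level₃ with b ≡ᵇ 0
  ... | false = ≡.refl
  ... | true  = level₂

constant-homomorphism : CommutativeRing.rawRing ℤ-ring -Raw-AlmostCommutative⟶ fromCommutativeRing PS-ring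
constant-homomorphism = record
  { ⟦_⟧    = constant
  ; +-homo = λ r s a b c d → if-+ (origin a b c d) r s
  ; *-homo = λ r s → trans (constant≈monomial (r *ℤ s)) (sym (trans (*-cong (constant≈monomial r) (constant≈monomial s))
                    (trans (⊗≡*ₛ (S₄.monomial 0 (constant₃ r)) (S₄.monomial 0 (constant₃ s)))
                    (trans (S₄.monomial-*ₛ-monomial 0 0 (constant₃ r) (constant₃ s))
                    (S₄.monomial-cong 0 (R₃.trans
                      (S₃.monomial-*ₛ-monomial 0 0 (S₂.monomial 0 (S₁.monomial 0 r)) (S₂.monomial 0 (S₁.monomial 0 s)))
                    (S₃.monomial-cong 0 (R₂.trans (S₂.monomial-*ₛ-monomial 0 0 (S₁.monomial 0 r) (S₁.monomial 0 s))
                    (S₂.monomial-cong 0 (S₁.monomial-*ₛ-monomial 0 0 r s))))))))))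
  ; -‿homo = λ r a b c d → if-- (origin a b c d) r
  ; 0-homo = λ a b c d → if-0 (origin a b c d)
  ; 1-homo = refl
  }
  where
  origin : ℕ → ℕ → ℕ → ℕ → Bool
  origin a b c d = (a ≡ᵇ 0) ∧ ((b ≡ᵇ 0) ∧ ((c ≡ᵇ 0) ∧ (d ≡ᵇ 0)))
  if-+ : ∀ x r s → (if x then r +ℤ s else + 0) ≡ (if x then r else + 0) +ℤ (if x then s else + 0)
  if-+ true  r s = ≡.refl
  if-+ false r s = ≡.refl
  if-- : ∀ x r → (if x then -ℤ r else + 0) ≡ -ℤ (if x then r else + 0)
  if-- true  r = ≡.refl
  if-- false r = ≡.refl
  if-0 : ∀ x → (if x then + 0 else + 0) ≡ + 0
  if-0 true  = ≡.refl
  if-0 false = ≡.refl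

open RingAlgebra PS-ring constant-homomorphism using (eliminate; distribute; column-equation-cong)

pow-cong : ∀ {f g} k → f ≈ g → pow f k ≈ pow g k
pow-cong zero    f≈g = refl
pow-cong (suc k) f≈g = *-cong (pow-cong k f≈g) f≈g

monomial₄-cong : ∀ {a b c d a′ b′ c′ d′} → a ≡ a′ → b ≡ b′ → c ≡ c′ → d ≡ d′ → monomial₄ a b c d ≈ monomial₄ a′ b′ c′ d′
monomial₄-cong ≡.refl ≡.refl ≡.refl ≡.refl = refl

pow-monomial₄ : ∀ k a b c d → pow (monomial₄ a b c d) k ≈ monomial₄ (k ℕ.* a) (k ℕ.* b) (k ℕ.* c) (k ℕ.* d)
pow-monomial₄ zero    a b c d = one≈1ₛ
pow-monomial₄ (suc k) a b c d = trans (*-cong (pow-monomial₄ k a b c d) (refl {monomial₄ a b c d}))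
  (trans (monomial₄-⊗-monomial₄ (k ℕ.* a) (k ℕ.* b) (k ℕ.* c) (k ℕ.* d) a b c d)
         (monomial₄-cong (ℕ.+-comm (k ℕ.* a) a) (ℕ.+-comm (k ℕ.* b) b) (ℕ.+-comm (k ℕ.* c) c) (ℕ.+-comm (k ℕ.* d) d)))

rotate-cong : ∀ {f g} → f ≈ g → rotate f ≈ rotate g
rotate-cong f≈g d a b c = f≈g a b c d

⊗-monomial₄ : ∀ {f g a b c d a′ b′ c′ d′} → f ≈ monomial₄ a b c d → g ≈ monomial₄ a′ b′ c′ d′ →
          f ⊗ g ≈ monomial₄ (a ℕ.+ a′) (b ℕ.+ b′) (c ℕ.+ c′) (d ℕ.+ d′)
⊗-monomial₄ {a = a} {b} {c} {d} {a′} {b′} {c′} {d′} f≈ g≈ = trans (*-cong f≈ g≈) (monomial₄-⊗-monomial₄ a b c d a′ b′ c′ d′)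

Y⊗U≈ : Y ⊗ U ≈ monomial₄ 0 1 0 1
Y⊗U≈ = ⊗-monomial₄ Y≈ U≈

Q≈ : Q ≈ monomial₄ 0 1 1 0
Q≈ = ⊗-monomial₄ Y≈ Z≈

Q⊗U≈ : Q ⊗ U ≈ monomial₄ 0 1 1 1
Q⊗U≈ = ⊗-monomial₄ Q≈ U≈

X⊗Y⊗U≈ : X ⊗ Y ⊗ U ≈ monomial₄ 1 1 0 1
X⊗Y⊗U≈ = ⊗-monomial₄ (⊗-monomial₄ X≈ Y≈) U≈

X⊗Q⊗U≈ : X ⊗ Q ⊗ U ≈ monomial₄ 1 1 1 1
X⊗Q⊗U≈ = ⊗-monomial₄ (⊗-monomial₄ X≈ Q≈) U≈

pow-X≈ : ∀ k → pow X k ≈ monomial₄ k 0 0 0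
pow-X≈ k = trans (pow-cong k X≈) (trans (pow-monomial₄ k 1 0 0 0)
  (monomial₄-cong (ℕ.*-identityʳ k) (ℕ.*-zeroʳ k) (ℕ.*-zeroʳ k) (ℕ.*-zeroʳ k)))

pow-Y≈ : ∀ k → pow Y k ≈ monomial₄ 0 k 0 0
pow-Y≈ k = trans (pow-cong k Y≈) (trans (pow-monomial₄ k 0 1 0 0)
  (monomial₄-cong (ℕ.*-zeroʳ k) (ℕ.*-identityʳ k) (ℕ.*-zeroʳ k) (ℕ.*-zeroʳ k)))

pow-Q≈ : ∀ k → pow Q k ≈ monomial₄ 0 k k 0
pow-Q≈ k = trans (pow-cong k Q≈) (trans (pow-monomial₄ k 0 1 1 0)
  (monomial₄-cong (ℕ.*-zeroʳ k) (ℕ.*-identityʳ k) (ℕ.*-identityʳ k) (ℕ.*-zeroʳ k)))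

pow-U≈ : ∀ k → pow U k ≈ monomial₄ 0 0 0 k
pow-U≈ k = trans (pow-cong k U≈) (trans (pow-monomial₄ k 0 0 0 1)
  (monomial₄-cong (ℕ.*-zeroʳ k) (ℕ.*-zeroʳ k) (ℕ.*-zeroʳ k) (ℕ.*-identityʳ k)))

x²y²qu³≈ : pow X 2 ⊗ pow Y 2 ⊗ Q ⊗ pow U 3 ≈ monomial₄ 2 3 1 3
x²y²qu³≈ = ⊗-monomial₄ (⊗-monomial₄ (⊗-monomial₄ (pow-X≈ 2) (pow-Y≈ 2)) Q≈) (pow-U≈ 3)

x²y²q²u⁴≈ : pow X 2 ⊗ pow Y 2 ⊗ pow Q 2 ⊗ pow U 4 ≈ monomial₄ 2 4 2 4
x²y²q²u⁴≈ = ⊗-monomial₄ (⊗-monomial₄ (⊗-monomial₄ (pow-X≈ 2) (pow-Y≈ 2)) (pow-Q≈ 2)) (pow-U≈ 4)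

F-equation : F ⊕ (X ⊗ Y ⊗ U ⊗ (Y ⊗ U) ⊕ X ⊗ Y ⊗ U ⊗ (Y ⊗ U) ⊗ substitute 1 0 G) ≈
             Y ⊗ U ⊗ F ⊕ (X ⊗ Y ⊗ U ⊕ X ⊗ Y ⊗ U ⊗ G1)
F-equation = column-equation-cong (sym F≈) (sym G1≈) (sym Gy≈) (sym X⊗Y⊗U≈) (sym Y⊗U≈)
  (ColumnEquation.column-equation (monomial₃ 1 0 1) (λ r k → monomial₃ (k ℕ.+ evenCells r) (oddCells r) k)
     (λ r k → R₃.sym (monomial₃-*ₛ-monomial₃ 1 0 1 (k ℕ.+ evenCells r) (oddCells r) k))
     {λ r → monomial₃ (oddCells r) (evenCells r) (lastR r)} {λ r → monomial₃ (evenCells r) (oddCells r) 0}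
     {λ r → monomial₃ (lastR r ℕ.+ evenCells r) (oddCells r) (lastR r)}
     R₃.refl (λ _ _ _ → R₃.refl) (λ _ _ → R₃.refl) (λ _ _ → R₃.refl))

Gy-equation : substitute 1 0 G ⊕ (X ⊗ Q ⊗ U ⊗ (Q ⊗ U) ⊕ X ⊗ Q ⊗ U ⊗ (Q ⊗ U) ⊗ substQ 1 F) ≈
              Q ⊗ U ⊗ substitute 1 0 G ⊕ (X ⊗ Q ⊗ U ⊕ X ⊗ Q ⊗ U ⊗ F1)
Gy-equation = column-equation-cong (sym Gy≈) (sym F1≈) (sym Fq≈) (sym X⊗Q⊗U≈) (sym Q⊗U≈)
  (ColumnEquation.column-equation (monomial₃ 1 1 1) (λ r k → monomial₃ (k ℕ.+ oddCells r) (k ℕ.+ evenCells r) k)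
     (λ r k → R₃.sym (monomial₃-*ₛ-monomial₃ 1 1 1 (k ℕ.+ oddCells r) (k ℕ.+ evenCells r) k))
     {λ r → monomial₃ (lastR r ℕ.+ evenCells r) (oddCells r) (lastR r)} {λ r → monomial₃ (oddCells r) (evenCells r) 0}
     {λ r → monomial₃ (lastR r ℕ.+ oddCells r) (lastR r ℕ.+ evenCells r) (lastR r)}
     R₃.refl (λ _ _ _ → R₃.refl) (λ _ _ → R₃.refl) (λ _ _ → R₃.refl))

functional-equation : F ≈ Ay ⊕ By ⊗ substQ 1 F
functional-equation = eliminate
  {F} {substitute 1 0 G} {G1} {F1} {substQ 1 F} {inv1m (Y ⊗ U)} {inv1m (Q ⊗ U)}
  {X ⊗ Y ⊗ U} {Y ⊗ U} {X ⊗ Q ⊗ U} {Q ⊗ U} {pow X 2 ⊗ pow Y 2 ⊗ Q ⊗ pow U 3} {pow X 2 ⊗ pow Y 2 ⊗ pow Q 2 ⊗ pow U 4}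
  F-equation Gy-equation
  (inv1m-inverse (Y ⊗ U) (monomial₃ 0 1 0) (trans (rotate-cong Y⊗U≈) (rotate-monomial₄ 0 1 0 1)))
  (inv1m-inverse (Q ⊗ U) (monomial₃ 0 1 1) (trans (rotate-cong Q⊗U≈) (rotate-monomial₄ 0 1 1 1)))
  (trans (⊗-monomial₄ (⊗-monomial₄ X⊗Y⊗U≈ Y⊗U≈) X⊗Q⊗U≈) (sym x²y²qu³≈))
  (trans (⊗-monomial₄ (⊗-monomial₄ (⊗-monomial₄ X⊗Y⊗U≈ Y⊗U≈) X⊗Q⊗U≈) Q⊗U≈) (sym x²y²q²u⁴≈))

substitute-≡ : ∀ {p p′ r r′} f → p ≡ p′ → r ≡ r′ → substitute p r f ≈ substitute p′ r′ f
substitute-≡ f ≡.refl ≡.refl = refl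

substQ-substQ : ∀ M f → substQ M (substQ 1 f) ≈ substQ (suc M) f
substQ-substQ M f = trans (substitute-substitute M M 1 1 f) (substitute-≡ f (ℕ.+-comm M 1) (ℕ.+-comm M 1))

shifted-functional-equation : ∀ M → substQ M F ≈ substQ M Ay ⊕ substQ M By ⊗ substQ (suc M) F
shifted-functional-equation M = trans (substitute-cong M M functional-equation)
  (trans (substitute-⊕ M M Ay (By ⊗ substQ 1 F))
         (+-congˡ {substQ M Ay} (trans (substitute-⊗ M M By (substQ 1 F)) (*-congˡ {substQ M By} (substQ-substQ M F)))))

iterate : ∀ M → F ≈ partialSum M ⊕ prodB M ⊗ substQ M F
iterate zero    = sym (trans (+-cong {partialSum 0} {0#} (λ _ _ _ _ → ≡.refl) (*-congˡ {one} {substQ 0 F} {F} (λ _ _ _ _ → ≡.refl)))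
                           (trans (+-identityˡ (one ⊗ F)) (*-identityˡ F)))
iterate (suc M) = trans (iterate M)
  (trans (+-congˡ {partialSum M} (*-congˡ {prodB M} (shifted-functional-equation M)))
         (distribute (partialSum M) (prodB M) (substQ M Ay) (substQ M By) (substQ (suc M) F)))

VanishesBelow : ℕ → PS → Set
VanishesBelow = S₄.VanishesBelow

vanishesBelow-0 : ∀ f → VanishesBelow 0 f
vanishesBelow-0 f n ()

vanishesBelow-≤ : ∀ {k m f} → m ≤ k → VanishesBelow k f → VanishesBelow m f
vanishesBelow-≤ m≤k f≈0 n n<m = f≈0 n (ℕ.<-≤-trans n<m m≤k)

⊗-vanishesBelow : ∀ k m {f g} → VanishesBelow k f → VanishesBelow m g → VanishesBelow (k ℕ.+ m) (f ⊗ g)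
⊗-vanishesBelow k m {f} {g} f≈0 g≈0 n n<k+m = R₃.trans (⊗≡*ₛ f g n) (S₄.*ₛ-vanishesBelow k m f≈0 g≈0 n n<k+m)

vanishesBelow-⊗ʳ : ∀ k f g → VanishesBelow k f → VanishesBelow k (f ⊗ g)
vanishesBelow-⊗ʳ k f g f≈0 =
  vanishesBelow-≤ {k ℕ.+ 0} {k} {f ⊗ g} (ℕ.≤-reflexive (≡.sym (ℕ.+-identityʳ k)))
                  (⊗-vanishesBelow k 0 {f} {g} f≈0 (vanishesBelow-0 g))

By-vanishesBelow : VanishesBelow 2 By
By-vanishesBelow = vanishesBelow-⊗ʳ 2 _ (inv1m (Q ⊗ U)) (vanishesBelow-⊗ʳ 2 _ (inv1m (Y ⊗ U))
  (vanishesBelow-⊗ʳ 2 _ (pow U 4) (vanishesBelow-⊗ʳ 2 _ (pow Q 2) (vanishesBelow-⊗ʳ 2 (pow X 2) (pow Y 2) x²))))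
  where
  x² : VanishesBelow 2 (pow X 2)
  x² n n<2 = R₃.trans (pow-X≈ 2 n) (S₄.monomial-vanishesBelow 2 (monomial₃ 0 0 0) n n<2)

prodB-vanishesBelow : ∀ M → VanishesBelow M (prodB M)
prodB-vanishesBelow zero    = vanishesBelow-0 (prodB 0)
prodB-vanishesBelow (suc M) =
  vanishesBelow-≤ {M ℕ.+ 2} {suc M} {prodB M ⊗ substQ M By} (ℕ.≤-trans (ℕ.n≤1+n (suc M)) (ℕ.≤-reflexive (ℕ.+-comm 2 M)))
    (⊗-vanishesBelow M 2 {prodB M} {substQ M By} (prodB-vanishesBelow M) (substitute-vanishesBelow M M 2 {By} By-vanishesBelow))

remainder-vanishes : ∀ M a → a < M → (prodB M ⊗ substQ M F) a S₃.≈ₛ S₃.0ₛ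
remainder-vanishes M a = vanishesBelow-⊗ʳ M (prodB M) (substQ M F) (prodB-vanishesBelow M) a

lemma5p3 : ∀ (a b c d : ℕ) → ∃[ N ] (∀ (M : ℕ) → N ≤ M → F a b c d ≡ partialSum M a b c d)
lemma5p3 a b c d = suc a , λ M a<M → ≡.trans (iterate M a b c d)
  (≡.trans (≡.cong (partialSum M a b c d +ℤ_) (remainder-vanishes M a a<M b c d)) (ℤ.+-identityʳ _))
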